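{- Let $\varepsilon\in(0,1/4)$, $d\ge1/\varepsilon$ an integer, $c>0$, and let $K=(V,E_K)$ be an $(\varepsilon,d)$-kernel of a graph $G=(V,E)$. Then any maximal matching $M$ of $K$ that matches at least a $(1-c\varepsilon)$-fraction of the vertices of $H_K:=\{v: d_K(v)\ge d(1-\varepsilon)\}$ is a $4c\varepsilon$-approximately maximal matching in $G$. Moreover, such a matching exists for $c=2$.
   Context: For $\varepsilon\in[0,1]$ and $d\in\mathbb N$, a subgraph $K=(V,E_K)$ of $G=(V,E)$ is an $(\varepsilon,d)$-kernel if every vertex has degree at most $d$ in $K$ and every edge of $E\setminus E_K$ has at least one endpoint whose degree $d_K$ in $K$ is at least $d(1-\varepsilon)$. $\mu(G)$ is the maximum matching size. A matching $M$ is an $\varepsilon'$-approximately maximal matching in $G$ if it is inclusion-wise maximal in some subgraph obtained from $G$ by deleting at most $\varepsilon'\mu(G)$ vertices.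
   Formalization: The parameters ε and c take rational values. -}

module Defs where

open import Data.Nat using (ℕ; zero; suc; _+_; _≤_; _<_)
open import Data.Bool using (Bool; true; false; if_then_else_; T; not; _∧_)
open import Data.Fin using (Fin; toℕ)
open import Data.List using (List; map; allFin)
open import Data.Nat.ListAction using (sum)
open import Data.Product using (Σ; ∃; _×_; _,_)
open import Data.Sum using (_⊎_)
open import Data.Integer using (+_)
open import Data.Rational using (ℚ; _/_; 1ℚ) renaming (_≤_ to _≤ℚ_; _*_ to _*ℚ_; _-_ to _-ℚ_)
open import Relation.Binary.PropositionalEquality using (_≡_)

record Graph (n : ℕ) : Set where
  field
    adj   : Fin n → Fin n → Bool
    sym   : ∀ i j → adj i j ≡ adj j i
    irrefl : ∀ i → adj i i ≡ false
open Graph public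

ℕ→ℚ : ℕ → ℚ
ℕ→ℚ k = (+ k) / 1

count : ∀ {n} → (Fin n → Bool) → ℕ
count {n} P = sum (map (λ j → if P j then 1 else 0) (allFin n))

deg : ∀ {n} → Graph n → Fin n → ℕ
deg G v = count (adj G v)

numEdges : ∀ {n} → Graph n → ℕ
numEdges {n} G = sum (map (λ i → count (λ j → if toℕ i Data.Nat.<ᵇ toℕ j then adj G i j else false)) (allFin n))
  where import Data.Nat

_⊆G_ : ∀ {n} → Graph n → Graph n → Set
H ⊆G G = ∀ i j → T (adj H i j) → T (adj G i j)

IsKernel : ∀ {n} → ℚ → ℕ → Graph n → Graph n → Set
IsKernel ε d G K =
  (K ⊆G G)
  × (∀ v → deg K v ≤ d)
  × (∀ u v → T (adj G u v) → T (not (adj K u v)) →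
       (ℕ→ℚ d *ℚ (1ℚ -ℚ ε) ≤ℚ ℕ→ℚ (deg K u)) ⊎ (ℕ→ℚ d *ℚ (1ℚ -ℚ ε) ≤ℚ ℕ→ℚ (deg K v)))

IsMatching : ∀ {n} → Graph n → Graph n → Set
IsMatching G M = (M ⊆G G) × (∀ v → deg M v ≤ 1)

Matched : ∀ {n} → Graph n → Fin n → Set
Matched M v = 1 ≤ deg M v

IsMaximalMatching : ∀ {n} → Graph n → Graph n → Set
IsMaximalMatching G M =
  IsMatching G M × (∀ u v → T (adj G u v) → Matched M u ⊎ Matched M v)

IsMaximumMatching : ∀ {n} → Graph n → Graph n → Set
IsMaximumMatching G M = IsMatching G M × (∀ M' → IsMatching G M' → numEdges M' ≤ numEdges M)

-- G with the vertex set D (given as a Boolean predicate) deleted: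
-- deleted vertices become isolated (equivalently, the induced subgraph on V ∖ D)
deleteVertices : ∀ {n} → Graph n → (Fin n → Bool) → Graph n
deleteVertices {n} G D = record
  { adj = λ i j → adj G i j ∧ (not (D i) ∧ not (D j))
  ; sym = λ i j → lemma i j
  ; irrefl = λ i → lemma2 i }
  where
  open import Relation.Binary.PropositionalEquality using (cong₂; refl)
  open import Data.Bool.Properties using (∧-comm)
  lemma : ∀ i j → (adj G i j ∧ (not (D i) ∧ not (D j))) ≡ (adj G j i ∧ (not (D j) ∧ not (D i)))
  lemma i j = cong₂ _∧_ (sym G i j) (∧-comm (not (D i)) (not (D j)))
  lemma2 : ∀ i → (adj G i i ∧ (not (D i) ∧ not (D i))) ≡ false
  lemma2 i rewrite irrefl G i = refl

-- ε'-approximately maximal matching in G: for the maximum matching size μ(G),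
-- some set D of at most ε'·μ(G) vertices can be deleted so that M is a maximal
-- matching of G − D.
IsApproxMaximalMatching : ∀ {n} → ℚ → Graph n → Graph n → Set
IsApproxMaximalMatching {n} ε' G M =
  ∀ Mstar → IsMaximumMatching G Mstar →
  Σ (Fin n → Bool) λ D →
    (ℕ→ℚ (count D) ≤ℚ ε' *ℚ ℕ→ℚ (numEdges Mstar))
    × IsMaximalMatching (deleteVertices G D) M

inH : ∀ {n} → ℚ → ℕ → Graph n → Fin n → Bool
inH ε d K v = Data.Rational._≤ᵇ_ (ℕ→ℚ d *ℚ (1ℚ -ℚ ε)) (ℕ→ℚ (deg K v))
  where import Data.Rational

matchedᵇ : ∀ {n} → Graph n → Fin n → Bool
matchedᵇ M v = Data.Nat._≤ᵇ_ 1 (deg M v)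
  where import Data.Nat

sizeH : ∀ {n} → ℚ → ℕ → Graph n → ℕ
sizeH ε d K = count (inH ε d K)

matchedH : ∀ {n} → ℚ → ℕ → Graph n → Graph n → ℕ
matchedH ε d K M = count (λ v → inH ε d K v ∧ matchedᵇ M v)

{-# OPTIONS --safe #-}

-- By Vizing's
-- theorem K has a proper edge colouring with d + 1 colours; the colour classes are matchings which
-- together meet every v ∈ H_K exactly deg_K v times, so one of them matches at least
-- d(1 - ε)|H_K| / (d + 1) ≥ (1 - 2ε)|H_K| vertices of H_K, using dε ≥ 1.  Extending it greedily gives
-- the maximal matching of the second claim.  As a matching of G it has at most 2μ(G) matched vertices,
-- hence |H_K| ≤ 4μ(G) when ε < 1/4.  For the first claim delete the set D of unmatched vertices of H_K:
-- an edge of G - D that is not in K has an endpoint of high K-degree by the kernel property, and that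
-- endpoint is matched since it is not in D; so M is maximal in G - D, and |D| ≤ cε|H_K| ≤ 4cε μ(G).

module Submission where

import Data.Nat
import Defs

module Counting where

  open import Data.Nat using (ℕ; zero; suc; _+_; _*_; _≤_; z≤n; s≤s)
  open import Data.Nat.Properties
    using (≤-refl; ≤-reflexive; ≤-trans; ≤-total; +-mono-≤; +-monoʳ-≤; *-monoʳ-≤; m≤m+n; m≤n+m;
           +-0-commutativeMonoid)
  open import Data.Bool using (Bool; true; false; if_then_else_; T; not; _∧_)
  open import Data.Fin using (Fin; zero; suc; _≟_)
  open import Data.Fin.Properties using (suc-injective)
  open import Data.List using (map; tabulate; allFin)
  open import Data.List.Properties using (map-tabulate)
  import Data.Nat.ListAction as List
  open import Data.Product using (∃; _,_)
  open import Data.Sum using (inj₁; inj₂)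
  open import Data.Empty using (⊥-elim)
  open import Function using (_∘_)
  open import Relation.Nullary using (yes; no)
  open import Relation.Nullary.Decidable using (⌊_⌋)
  open import Relation.Binary.PropositionalEquality
    using (_≡_; refl; sym; cong; cong₂; trans; subst; subst₂; module ≡-Reasoning)
  open import Defs using (count)
  open import Algebra.Properties.CommutativeMonoid.Sum +-0-commutativeMonoid public
    using (sum; sum-syntax; ∑-comm; ∑-distrib-+; sum-cong-≗; sum-replicate-zero)

  χ : Bool → ℕ
  χ b = if b then 1 else 0

  T⇒1≤χ : ∀ {b} → T b → 1 ≤ χ b
  T⇒1≤χ {true} _ = ≤-refl

  χ-mono : ∀ {a b} → (T a → T b) → χ a ≤ χ b
  χ-mono {false}          _ = z≤n
  χ-mono {true} {true}    _ = ≤-refl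
  χ-mono {true} {false} a⇒b = ⊥-elim (a⇒b _)

  sum-tabulate : ∀ {n} (f : Fin n → ℕ) → List.sum (tabulate f) ≡ sum f
  sum-tabulate {zero}  f = refl
  sum-tabulate {suc n} f = cong (f zero +_) (sum-tabulate (f ∘ suc))

  sum-allFin : ∀ {n} (f : Fin n → ℕ) → List.sum (map f (allFin n)) ≡ sum f
  sum-allFin f = trans (cong List.sum (map-tabulate (λ i → i) f)) (sum-tabulate f)

  count≡∑χ : ∀ {n} (P : Fin n → Bool) → count P ≡ ∑[ i < n ] χ (P i)
  count≡∑χ P = sum-allFin (χ ∘ P)

  ∑-mono-≤ : ∀ {n} {f g : Fin n → ℕ} → (∀ i → f i ≤ g i) → sum f ≤ sum g
  ∑-mono-≤ {zero}  f≤g = z≤n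
  ∑-mono-≤ {suc n} f≤g = +-mono-≤ (f≤g zero) (∑-mono-≤ (f≤g ∘ suc))

  term≤∑ : ∀ {n} (f : Fin n → ℕ) i → f i ≤ sum f
  term≤∑ f zero    = m≤m+n (f zero) _
  term≤∑ f (suc i) = ≤-trans (term≤∑ (f ∘ suc) i) (m≤n+m _ (f zero))

  ∑-ones : ∀ n → ∑[ i < n ] 1 ≡ n
  ∑-ones zero    = refl
  ∑-ones (suc n) = cong suc (∑-ones n)

  ∑≤size*largest : ∀ {m} (f : Fin (suc m) → ℕ) → ∃ λ i → sum f ≤ suc m * f i
  ∑≤size*largest {zero}  f = zero , ≤-refl
  ∑≤size*largest {suc m} f with ∑≤size*largest (f ∘ suc)
  ... | i , ∑≤ with ≤-total (f zero) (f (suc i))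
  ... | inj₁ f0≤fi = suc i , +-mono-≤ f0≤fi ∑≤
  ... | inj₂ fi≤f0 = zero , +-monoʳ-≤ (f zero) (≤-trans ∑≤ (*-monoʳ-≤ (suc m) fi≤f0))

  ∑χ≟≡1 : ∀ {n} (a : Fin n) → ∑[ j < n ] χ ⌊ a ≟ j ⌋ ≡ 1
  ∑χ≟≡1 {suc n} zero    = cong suc (sum-replicate-zero n)
  ∑χ≟≡1 {suc n} (suc a) = trans (sum-cong-≗ χ⌊suc≟suc⌋) (∑χ≟≡1 a)
    where
    χ⌊suc≟suc⌋ : ∀ j → χ ⌊ suc a ≟ suc j ⌋ ≡ χ ⌊ a ≟ j ⌋
    χ⌊suc≟suc⌋ j with a ≟ j
    ... | yes _ = refl
    ... | no _  = refl

  AtMostOne : ∀ {n} → (Fin n → Bool) → Set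
  AtMostOne P = ∀ i j → T (P i) → T (P j) → i ≡ j

  atMostOne⇒∑χ≤1 : ∀ {n} (P : Fin n → Bool) → AtMostOne P → ∑[ i < n ] χ (P i) ≤ 1
  atMostOne⇒∑χ≤1 {zero}  P _ = z≤n
  atMostOne⇒∑χ≤1 {suc n} P unique with P zero in P0
  ... | false = atMostOne⇒∑χ≤1 (P ∘ suc) (λ i j Pi Pj → suc-injective (unique (suc i) (suc j) Pi Pj))
  ... | true  = s≤s (≤-trans (∑-mono-≤ rest≤0) (≤-reflexive (sum-replicate-zero n)))
    where
    rest≤0 : ∀ i → χ (P (suc i)) ≤ 0
    rest≤0 i with P (suc i) in Pi
    ... | false = z≤n
    ... | true with unique zero (suc i) (subst T (sym P0) _) (subst T (sym Pi) _)
    ... | ()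

  ∑χ≤1⇒atMostOne : ∀ {n} (P : Fin n → Bool) → ∑[ i < n ] χ (P i) ≤ 1 → AtMostOne P
  ∑χ≤1⇒atMostOne P ∑≤1 zero    zero    _  _  = refl
  ∑χ≤1⇒atMostOne P ∑≤1 zero    (suc j) P0 Pj
    with ≤-trans (+-mono-≤ (T⇒1≤χ P0) (≤-trans (T⇒1≤χ Pj) (term≤∑ (χ ∘ P ∘ suc) j))) ∑≤1
  ... | s≤s ()
  ∑χ≤1⇒atMostOne P ∑≤1 (suc i) zero    Pi P0 = sym (∑χ≤1⇒atMostOne P ∑≤1 zero (suc i) P0 Pi)
  ∑χ≤1⇒atMostOne P ∑≤1 (suc i) (suc j) Pi Pj =
    cong suc (∑χ≤1⇒atMostOne (P ∘ suc) (≤-trans (m≤n+m _ (χ (P zero))) ∑≤1) i j Pi Pj)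

  count-mono : ∀ {n} {P Q : Fin n → Bool} → (∀ v → T (P v) → T (Q v)) → count P ≤ count Q
  count-mono {P = P} {Q} P⇒Q =
    subst₂ _≤_ (sym (count≡∑χ P)) (sym (count≡∑χ Q)) (∑-mono-≤ (λ v → χ-mono (P⇒Q v)))

  count-split : ∀ {n} (h m : Fin n → Bool) →
    count (λ v → h v ∧ not (m v)) + count (λ v → h v ∧ m v) ≡ count h
  count-split {n} h m = begin
    count (λ v → h v ∧ not (m v)) + count (λ v → h v ∧ m v)
      ≡⟨ cong₂ _+_ (count≡∑χ (λ v → h v ∧ not (m v))) (count≡∑χ (λ v → h v ∧ m v)) ⟩
    ∑[ v < n ] χ (h v ∧ not (m v)) + ∑[ v < n ] χ (h v ∧ m v)
      ≡⟨ sym (∑-distrib-+ (λ v → χ (h v ∧ not (m v))) (λ v → χ (h v ∧ m v))) ⟩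
    ∑[ v < n ] (χ (h v ∧ not (m v)) + χ (h v ∧ m v))
      ≡⟨ sum-cong-≗ (λ v → χ-split (h v) (m v)) ⟩
    ∑[ v < n ] χ (h v)
      ≡⟨ sym (count≡∑χ h) ⟩
    count h ∎
    where
    open ≡-Reasoning
    χ-split : ∀ a b → χ (a ∧ not b) + χ (a ∧ b) ≡ χ a
    χ-split true  true  = refl
    χ-split true  false = refl
    χ-split false _     = refl

module UniqueLists where

  open import Data.Nat using (_≤_)
  open import Data.Fin using (Fin; zero; suc)
  open import Data.Fin.Properties using (injective⇒≤)
  open import Data.List using (List; []; _∷_; _++_; [_]; length; lookup)
  open import Data.List.Membership.Propositional using (_∈_; _∉_)
  open import Data.List.Membership.Propositional.Properties using (∈-lookup; ∈-++⁺ˡ; ∈-++⁺ʳ)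
  open import Data.List.Relation.Unary.Any using (here; there)
  open import Data.List.Relation.Unary.All as All using ([]; _∷_)
  open import Data.List.Relation.Unary.AllPairs using ([]; _∷_)
  open import Data.List.Relation.Unary.Unique.Propositional using (Unique)
  open import Data.List.Relation.Unary.Unique.Propositional.Properties using (++⁺)
  open import Data.Product using (_×_; _,_)
  open import Data.Empty using (⊥-elim)
  open import Relation.Binary.PropositionalEquality using (_≡_; _≢_; refl; sym; cong)

  unique-lookup-injective : ∀ {A : Set} {xs : List A} → Unique xs → ∀ {i j} → lookup xs i ≡ lookup xs j → i ≡ j
  unique-lookup-injective (_  ∷ _) {zero}  {zero}  _  = refl
  unique-lookup-injective (x∉ ∷ _) {zero}  {suc j} eq = ⊥-elim (All.lookup x∉ (∈-lookup j) eq)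
  unique-lookup-injective (x∉ ∷ _) {suc i} {zero}  eq = ⊥-elim (All.lookup x∉ (∈-lookup i) (sym eq))
  unique-lookup-injective (_  ∷ u) {suc i} {suc j} eq = cong suc (unique-lookup-injective u eq)

  unique-length≤ : ∀ {n} {xs : List (Fin n)} → Unique xs → length xs ≤ n
  unique-length≤ u = injective⇒≤ (unique-lookup-injective u)

  unique-++⁻ : ∀ {A : Set} (xs : List A) {ys} → Unique (xs ++ ys) →
    Unique xs × Unique ys × (∀ {x y} → x ∈ xs → y ∈ ys → x ≢ y)
  unique-++⁻ []       u         = [] , u , λ ()
  unique-++⁻ (x ∷ xs) (x∉ ∷ u) with unique-++⁻ xs u
  ... | unique-xs , unique-ys , apart =
    All.tabulate (λ v∈xs → All.lookup x∉ (∈-++⁺ˡ v∈xs)) ∷ unique-xs , unique-ys ,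
    λ { (here refl) y∈ys → All.lookup x∉ (∈-++⁺ʳ xs y∈ys) ; (there x∈xs) y∈ys → apart x∈xs y∈ys }

  unique-snoc : ∀ {A : Set} {xs : List A} {w} → Unique xs → w ∉ xs → Unique (xs ++ [ w ])
  unique-snoc u w∉ = ++⁺ u ([] ∷ []) λ { (v∈xs , here refl) → w∉ v∈xs }

module Graphs where

  open import Data.Nat using (zero; suc; _+_; _≤_; _<_; _<ᵇ_; z≤n; s≤s)
  open import Data.Nat.Properties
    using (≤-trans; ≤-antisym; <-asym; ≮⇒≥; ≤ᵇ⇒≤; ≤⇒≤ᵇ; <ᵇ⇒<; <⇒<ᵇ; +-identityʳ;
           module ≤-Reasoning)
  open import Data.Bool using (Bool; true; false; T; _∧_; if_then_else_)
  open import Data.Fin using (Fin; toℕ; _≟_)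
  open import Data.Fin.Properties using (toℕ-injective)
  open import Data.Bool.Properties using (T-∧)
  open import Data.Product using (_×_; _,_; proj₂; map₂)
  open import Data.Sum using (_⊎_; inj₁; inj₂)
  open import Data.Empty using (⊥-elim)
  open import Function using (_∘_)
  open import Relation.Binary.PropositionalEquality
    using (_≡_; _≢_; refl; sym; trans; cong; cong₂; subst; module ≡-Reasoning)
  open import Function.Bundles using (_⇔_; mk⇔; module Equivalence)
  open import Relation.Nullary using (¬_; Dec)
  open import Relation.Nullary.Decidable using (_×-dec_; _⊎-dec_)
  open import Defs hiding (sym)
  open Counting

  deg≡∑χ : ∀ {n} (G : Graph n) v → deg G v ≡ ∑[ w < n ] χ (adj G v w)
  deg≡∑χ G v = count≡∑χ (adj G v)

  Matched⇔matchedᵇ : ∀ {n} (M : Graph n) v → Matched M v ⇔ T (matchedᵇ M v)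
  Matched⇔matchedᵇ M v = mk⇔ ≤⇒≤ᵇ (≤ᵇ⇒≤ 1 (deg M v))

  Ends : ∀ {n} → Fin n → Fin n → Fin n → Fin n → Set
  Ends a b u v = (u ≡ a × v ≡ b) ⊎ (u ≡ b × v ≡ a)

  ends? : ∀ {n} (a b u v : Fin n) → Dec (Ends a b u v)
  ends? a b u v = (u ≟ a ×-dec v ≟ b) ⊎-dec (u ≟ b ×-dec v ≟ a)

  ends-sym : ∀ {n} {a b u v : Fin n} → Ends a b u v → Ends a b v u
  ends-sym (inj₁ (u≡a , v≡b)) = inj₂ (v≡b , u≡a)
  ends-sym (inj₂ (u≡b , v≡a)) = inj₁ (v≡a , u≡b)

  χ-matched≡deg : ∀ {n} (M : Graph n) v → deg M v ≤ 1 → χ (matchedᵇ M v) ≡ deg M v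
  χ-matched≡deg M v deg≤1 with deg M v
  ... | zero     = refl
  ... | suc zero = refl
  ... | suc (suc _) with s≤s () ← deg≤1

  ⊆G-refl : ∀ {n} {G : Graph n} → G ⊆G G
  ⊆G-refl _ _ uv = uv

  edge⇒≢ : ∀ {n} (G : Graph n) {u v} → T (adj G u v) → u ≢ v
  edge⇒≢ G {u} uv refl = subst T (irrefl G u) uv

  edge-sym : ∀ {n} (G : Graph n) {u v} → T (adj G u v) → T (adj G v u)
  edge-sym G {u} {v} = subst T (Graph.sym G u v)

  deg≤1⇔atMostOne : ∀ {n} (M : Graph n) v → deg M v ≤ 1 ⇔ AtMostOne (adj M v)
  deg≤1⇔atMostOne M v = mk⇔
    (λ deg≤1 → ∑χ≤1⇒atMostOne (adj M v) (subst (_≤ 1) (deg≡∑χ M v) deg≤1))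
    (λ unique → subst (_≤ 1) (sym (deg≡∑χ M v)) (atMostOne⇒∑χ≤1 (adj M v) unique))

  edge⇒Matched : ∀ {n} (M : Graph n) {u w} → T (adj M u w) → Matched M u
  edge⇒Matched M {u} {w} uw = subst (1 ≤_) (sym (deg≡∑χ M u)) (≤-trans (T⇒1≤χ uw) (term≤∑ (χ ∘ adj M u) w))

  matchedCount-mono : ∀ {n} (h : Fin n → Bool) {M M′ : Graph n} → M ⊆G M′ →
    count (λ v → h v ∧ matchedᵇ M v) ≤ count (λ v → h v ∧ matchedᵇ M′ v)
  matchedCount-mono h {M} {M′} M⊆M′ =
    count-mono {P = λ v → h v ∧ matchedᵇ M v}
      (λ v hv∧m → Equivalence.from (T-∧ {h v}) (map₂ (matched-mono v) (Equivalence.to (T-∧ {h v}) hv∧m)))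
    where
    matched-mono : ∀ v → T (matchedᵇ M v) → T (matchedᵇ M′ v)
    matched-mono v m = Equivalence.to (Matched⇔matchedᵇ M′ v)
      (≤-trans (Equivalence.from (Matched⇔matchedᵇ M v) m) (count-mono (M⊆M′ v)))

  <ᵇ≡false⇒≮ : ∀ {a b} → (a <ᵇ b) ≡ false → ¬ a < b
  <ᵇ≡false⇒≮ a≮b a<b = subst T a≮b (<⇒<ᵇ a<b)

  handshake : ∀ {n} (G : Graph n) → ∑[ v < n ] deg G v ≡ numEdges G + numEdges G
  handshake {n} G = begin
    ∑[ i < n ] deg G i
      ≡⟨ sum-cong-≗ (λ i → trans (deg≡∑χ G i) (sum-cong-≗ (split-edge i))) ⟩
    ∑[ i < n ] ∑[ j < n ] (χ (before i j) + χ (before j i))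
      ≡⟨ sum-cong-≗ (λ i → ∑-distrib-+ (λ j → χ (before i j)) (λ j → χ (before j i))) ⟩
    ∑[ i < n ] (∑[ j < n ] χ (before i j) + ∑[ j < n ] χ (before j i))
      ≡⟨ ∑-distrib-+ (λ i → ∑[ j < n ] χ (before i j)) (λ i → ∑[ j < n ] χ (before j i)) ⟩
    ∑[ i < n ] ∑[ j < n ] χ (before i j) + ∑[ i < n ] ∑[ j < n ] χ (before j i)
      ≡⟨ cong (∑[ i < n ] ∑[ j < n ] χ (before i j) +_) (∑-comm (λ i j → χ (before j i))) ⟩
    ∑[ i < n ] ∑[ j < n ] χ (before i j) + ∑[ j < n ] ∑[ i < n ] χ (before j i)
      ≡⟨ cong₂ _+_ (sym numEdges≡) (sym numEdges≡) ⟩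
    numEdges G + numEdges G ∎
    where
    open ≡-Reasoning
    before : Fin n → Fin n → Bool
    before i j = if toℕ i <ᵇ toℕ j then adj G i j else false
    numEdges≡ : numEdges G ≡ ∑[ i < n ] ∑[ j < n ] χ (before i j)
    numEdges≡ = trans (sum-allFin (λ i → count (before i))) (sum-cong-≗ (λ i → count≡∑χ (before i)))
    split-edge : ∀ i j → χ (adj G i j) ≡ χ (before i j) + χ (before j i)
    split-edge i j with toℕ i <ᵇ toℕ j in i<j | toℕ j <ᵇ toℕ i in j<i
    ... | true  | true  =
      ⊥-elim (<-asym (<ᵇ⇒< (toℕ i) (toℕ j) (subst T (sym i<j) _)) (<ᵇ⇒< (toℕ j) (toℕ i) (subst T (sym j<i) _)))
    ... | true  | false = sym (+-identityʳ _)
    ... | false | true  = cong χ (Graph.sym G i j)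
    ... | false | false = cong χ (trans (cong (adj G i) (sym i≡j)) (irrefl G i))
      where
      i≡j : i ≡ j
      i≡j = toℕ-injective (≤-antisym (≮⇒≥ (<ᵇ≡false⇒≮ {toℕ j} j<i)) (≮⇒≥ (<ᵇ≡false⇒≮ {toℕ i} i<j)))

  χ-matched≤deg : ∀ {n} (M : Graph n) v → χ (matchedᵇ M v) ≤ deg M v
  χ-matched≤deg M v with matchedᵇ M v in matched
  ... | false = z≤n
  ... | true  = Equivalence.from (Matched⇔matchedᵇ M v) (subst T (sym matched) _)

  matchedCount≤2*numEdges : ∀ {n} (h : Fin n → Bool) (M : Graph n) →
    count (λ v → h v ∧ matchedᵇ M v) ≤ numEdges M + numEdges M
  matchedCount≤2*numEdges {n} h M = begin
    count (λ v → h v ∧ matchedᵇ M v)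
      ≤⟨ count-mono {P = λ v → h v ∧ matchedᵇ M v} (λ v → proj₂ ∘ Equivalence.to (T-∧ {h v})) ⟩
    count (matchedᵇ M)           ≡⟨ count≡∑χ (matchedᵇ M) ⟩
    ∑[ v < n ] χ (matchedᵇ M v)  ≤⟨ ∑-mono-≤ (χ-matched≤deg M) ⟩
    ∑[ v < n ] deg M v           ≡⟨ handshake M ⟩
    numEdges M + numEdges M      ∎
    where open ≤-Reasoning

module MaximalMatchings {n : Data.Nat.ℕ} (K : Defs.Graph n) where

  open import Data.Bool using (false; T; T?; _∨_)
  open import Data.Bool.Properties using (T-∨)
  open import Data.Fin using (Fin)
  open import Data.Fin.Properties using (any?)
  open import Data.List using (List; []; _∷_; cartesianProduct; allFin)
  open import Data.List.Membership.Propositional using (_∈_)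
  open import Data.List.Membership.Propositional.Properties using (∈-cartesianProduct⁺; ∈-allFin)
  open import Data.List.Relation.Unary.Any using (here; there)
  open import Data.Product using (∃; _×_; _,_)
  open import Data.Sum using (_⊎_; inj₁; inj₂)
  open import Data.Empty using (⊥-elim)
  open import Function.Bundles using (module Equivalence)
  open import Relation.Nullary using (¬_; Dec; yes; no)
  open import Relation.Nullary.Decidable using (⌊_⌋; toWitness; fromWitness)
  open import Relation.Binary.PropositionalEquality using (_≡_; _≢_; refl; sym; trans; cong₂)
  open Defs hiding (sym)
  open Counting using (AtMostOne)
  open Graphs using (Ends; ends?; ends-sym; edge⇒≢; edge-sym; edge⇒Matched; deg≤1⇔atMostOne; ⊆G-refl)

  Functional : Graph n → Set
  Functional M = ∀ u → AtMostOne (adj M u)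

  Matched′ : Graph n → Fin n → Set
  Matched′ M u = ∃ λ w → T (adj M u w)

  matched′? : ∀ (M : Graph n) u → Dec (Matched′ M u)
  matched′? M u = any? (λ w → T? (adj M u w))

  Covered : Graph n → Fin n → Fin n → Set
  Covered M u v = Matched′ M u ⊎ Matched′ M v

  covered-mono : ∀ {M M₁} → M ⊆G M₁ → ∀ {u v} → Covered M u v → Covered M₁ u v
  covered-mono M⊆M₁ {u} (inj₁ (w , uw)) = inj₁ (w , M⊆M₁ u w uw)
  covered-mono M⊆M₁ {_} {v} (inj₂ (w , vw)) = inj₂ (w , M⊆M₁ v w vw)

  Invariant : Graph n → List (Fin n × Fin n) → Set
  Invariant M pairs = ∀ u v → T (adj K u v) → Covered M u v ⊎ (u , v) ∈ pairs

  invariant-mono : ∀ {M M₁ pairs} → M ⊆G M₁ → Invariant M pairs → Invariant M₁ pairs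
  invariant-mono {M} {M₁} M⊆M₁ inv u v uv with inv u v uv
  ... | inj₁ cov = inj₁ (covered-mono {M} {M₁} M⊆M₁ cov)
  ... | inj₂ p   = inj₂ p

  invariant-tail : ∀ {M a b pairs} → Invariant M ((a , b) ∷ pairs) → (T (adj K a b) → Covered M a b) → Invariant M pairs
  invariant-tail inv covered u v uv with inv u v uv
  ... | inj₁ cov         = inj₁ cov
  ... | inj₂ (here refl) = inj₁ (covered uv)
  ... | inj₂ (there p)   = inj₂ p

  module _ (M : Graph n) {a b : Fin n} (a≢b : a ≢ b) where

    addEdge : Graph n
    addEdge = record
      { adj    = λ u v → adj M u v ∨ ⌊ ends? a b u v ⌋
      ; sym    = λ u v → cong₂ _∨_ (Graph.sym M u v) (ends?-sym u v)
      ; irrefl = λ u → cong₂ _∨_ (irrefl M u) (no-loop u)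
      }
      where
      ends?-sym : ∀ u v → ⌊ ends? a b u v ⌋ ≡ ⌊ ends? a b v u ⌋
      ends?-sym u v with ends? a b u v | ends? a b v u
      ... | yes _   | yes _   = refl
      ... | no _    | no _    = refl
      ... | yes uv  | no ¬vu  = ⊥-elim (¬vu (ends-sym uv))
      ... | no ¬uv  | yes vu  = ⊥-elim (¬uv (ends-sym vu))
      no-loop : ∀ u → ⌊ ends? a b u u ⌋ ≡ false
      no-loop u with ends? a b u u
      ... | no _                    = refl
      ... | yes (inj₁ (u≡a , u≡b)) = ⊥-elim (a≢b (trans (sym u≡a) u≡b))
      ... | yes (inj₂ (u≡b , u≡a)) = ⊥-elim (a≢b (trans (sym u≡a) u≡b))

    addEdge-old : M ⊆G addEdge
    addEdge-old u v uv = Equivalence.from T-∨ (inj₁ uv)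

    addEdge-new : T (adj addEdge a b)
    addEdge-new = Equivalence.from (T-∨ {adj M a b}) (inj₂ (fromWitness {a? = ends? a b a b} (inj₁ (refl , refl))))

    addEdge-cases : ∀ {u v} → T (adj addEdge u v) → T (adj M u v) ⊎ Ends a b u v
    addEdge-cases uv with Equivalence.to T-∨ uv
    ... | inj₁ old = inj₁ old
    ... | inj₂ new = inj₂ (toWitness new)

    addEdge-⊆ : M ⊆G K → T (adj K a b) → addEdge ⊆G K
    addEdge-⊆ M⊆K ab u v uv with addEdge-cases uv
    ... | inj₁ old                  = M⊆K u v old
    ... | inj₂ (inj₁ (refl , refl)) = ab
    ... | inj₂ (inj₂ (refl , refl)) = edge-sym K ab

    addEdge-functional : Functional M → ¬ Matched′ M a → ¬ Matched′ M b → Functional addEdge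
    addEdge-functional functional a-free b-free u v w uv uw with addEdge-cases uv | addEdge-cases uw
    ... | inj₁ old-v             | inj₁ old-w             = functional u v w old-v old-w
    ... | inj₁ old-v             | inj₂ (inj₁ (refl , _)) = ⊥-elim (a-free (v , old-v))
    ... | inj₁ old-v             | inj₂ (inj₂ (refl , _)) = ⊥-elim (b-free (v , old-v))
    ... | inj₂ (inj₁ (refl , _)) | inj₁ old-w             = ⊥-elim (a-free (w , old-w))
    ... | inj₂ (inj₂ (refl , _)) | inj₁ old-w             = ⊥-elim (b-free (w , old-w))
    ... | inj₂ (inj₁ (_ , refl)) | inj₂ (inj₁ (_ , refl)) = refl
    ... | inj₂ (inj₂ (_ , refl)) | inj₂ (inj₂ (_ , refl)) = refl
    ... | inj₂ (inj₁ (u≡a , _))  | inj₂ (inj₂ (u≡b , _))  = ⊥-elim (a≢b (trans (sym u≡a) u≡b))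
    ... | inj₂ (inj₂ (u≡b , _))  | inj₂ (inj₁ (u≡a , _))  = ⊥-elim (a≢b (trans (sym u≡a) u≡b))

  MaximalAbove : Graph n → Set
  MaximalAbove M = ∃ λ M′ → M ⊆G M′ × M′ ⊆G K × Functional M′ × (∀ u v → T (adj K u v) → Covered M′ u v)

  maximalAbove-⊆ : ∀ {M M₁} → M ⊆G M₁ → MaximalAbove M₁ → MaximalAbove M
  maximalAbove-⊆ M⊆M₁ (M′ , M₁⊆M′ , rest) = M′ , (λ u v uv → M₁⊆M′ u v (M⊆M₁ u v uv)) , rest

  greedy : ∀ pairs {M} → M ⊆G K → Functional M → Invariant M pairs → MaximalAbove M
  greedy [] {M} M⊆K functional inv = M , ⊆G-refl {G = M} , M⊆K , functional , covered
    where
    covered : ∀ u v → T (adj K u v) → Covered M u v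
    covered u v uv with inv u v uv
    ... | inj₁ cov = cov
  greedy ((a , b) ∷ pairs) {M} M⊆K functional inv with T? (adj K a b) | matched′? M a | matched′? M b
  ... | no ¬ab | _      | _      = greedy pairs {M} M⊆K functional (invariant-tail {M} inv λ ab → ⊥-elim (¬ab ab))
  ... | yes _  | yes ma | _      = greedy pairs {M} M⊆K functional (invariant-tail {M} inv λ _ → inj₁ ma)
  ... | yes _  | no _   | yes mb = greedy pairs {M} M⊆K functional (invariant-tail {M} inv λ _ → inj₂ mb)
  ... | yes ab | no a-free | no b-free = maximalAbove-⊆ {M} {M₁} (addEdge-old M a≢b)
    (greedy pairs {M₁} (addEdge-⊆ M a≢b M⊆K ab) (addEdge-functional M a≢b functional a-free b-free)
      (invariant-tail {M₁} (invariant-mono {M} {M₁} (addEdge-old M a≢b) inv) λ _ → inj₁ (b , addEdge-new M a≢b)))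
    where
    a≢b = edge⇒≢ K ab
    M₁ = addEdge M a≢b

  extend-to-maximal : ∀ {M} → IsMatching K M → ∃ λ M′ → IsMaximalMatching K M′ × M ⊆G M′
  extend-to-maximal {M} (M⊆K , deg≤1) = maximal-matching (greedy all-pairs {M} M⊆K functional listed)
    where
    all-pairs = cartesianProduct (allFin n) (allFin n)
    functional : Functional M
    functional u = Equivalence.to (deg≤1⇔atMostOne M u) (deg≤1 u)
    listed : Invariant M all-pairs
    listed u v _ = inj₂ (∈-cartesianProduct⁺ (∈-allFin u) (∈-allFin v))
    maximal-matching : MaximalAbove M → ∃ λ M′ → IsMaximalMatching K M′ × M ⊆G M′
    maximal-matching (M′ , M⊆M′ , M′⊆K , functional′ , covered′) =
      M′ , ((M′⊆K , λ v → Equivalence.from (deg≤1⇔atMostOne M′ v) (functional′ v)) , maximal) , M⊆M′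
      where
      maximal : ∀ u v → T (adj K u v) → Matched M′ u ⊎ Matched M′ v
      maximal u v uv with covered′ u v uv
      ... | inj₁ (_ , uw) = inj₁ (edge⇒Matched M′ uw)
      ... | inj₂ (_ , vw) = inj₂ (edge⇒Matched M′ vw)

-- Vizing's theorem by the Misra–Gries argument: an uncoloured edge xz gets a colour by rotating a
-- fan at x, after possibly exchanging two colours along an alternating path.
module EdgeColouring {n : Data.Nat.ℕ} (K : Defs.Graph n) (d : Data.Nat.ℕ) where

  open import Data.Nat using (ℕ; zero; suc; _+_; _*_; _≤_; _<_; _≤′_; ≤′-refl; ≤′-step; z≤n; s≤s; s≤s⁻¹)
  open import Data.Nat.Properties
    using (≤-trans; ≤⇒≤′; m≤n⇒m<n∨m≡n; n<1+n; _<?_; ≮⇒≥; <⇒≱; <-cmp; +-identityʳ; +-assoc;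
           module ≤-Reasoning)
  open import Relation.Binary using (tri<; tri≈; tri>)
  open import Data.Bool using (Bool; true; false; if_then_else_; T; T?; _∧_)
  open import Data.Fin using (Fin; toℕ; fromℕ<; _≟_)
  open import Function.Bundles using (module Equivalence)
  open import Data.Maybe as Maybe using (Maybe; just; nothing; _>>=_; is-just)
  open import Data.Maybe.Properties using (just-injective) renaming (≡-dec to ≡-dec-Maybe)
  open import Data.Fin.Properties using (any?; pigeonhole; toℕ≤pred[n]; toℕ-fromℕ<)
  open import Data.List using (List; []; _∷_; _++_; [_]; length; cartesianProduct; allFin)
  open import Data.List.Properties using (length-++)
  open import Data.List.Membership.Propositional using (_∈_)
  open import Data.List.Membership.Propositional.Properties using (∈-∃++; ∈-cartesianProduct⁺; ∈-allFin)
  open import Data.List.Membership.DecPropositional (_≟_ {n}) using (_∈?_)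
  open import Data.List.Relation.Unary.Any using (here; there)
  open import Data.List.Relation.Unary.All as All using ([]; _∷_)
  open import Data.List.Relation.Unary.AllPairs using ([]; _∷_)
  open import Data.List.Relation.Unary.Unique.Propositional using (Unique)
  open import Data.Product using (Σ; ∃; ∄; _×_; _,_; proj₁; proj₂)
  open import Data.Sum using (_⊎_; inj₁; inj₂)
  open import Data.Unit using (⊤; tt)
  open import Data.Empty using (⊥; ⊥-elim)
  open import Function using (case_of_)
  open import Relation.Nullary using (¬_; Dec; yes; no; ¬?)
  open import Relation.Nullary.Decidable using (⌊_⌋)
  open import Relation.Binary.PropositionalEquality using (_≡_; _≢_; refl; sym; trans; cong; subst; module ≡-Reasoning)
  open Defs hiding (sym)
  open Counting
  open Graphs using (edge⇒≢; edge-sym; deg≡∑χ; Ends; ends?; ends-sym; deg≤1⇔atMostOne; χ-matched≡deg)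
  open UniqueLists using (unique-length≤; unique-++⁻; unique-snoc)

  Colour : Set
  Colour = Fin (suc d)

  Colouring : Set
  Colouring = Fin n → Fin n → Maybe Colour

  record Proper (c : Colouring) : Set where
    field
      symmetric     : ∀ u v → c u v ≡ c v u
      coloured⇒edge : ∀ u v {γ} → c u v ≡ just γ → T (adj K u v)
      injective     : ∀ u v w {γ} → c u v ≡ just γ → c u w ≡ just γ → v ≡ w

    loopless : ∀ u v {γ} → c u v ≡ just γ → u ≢ v
    loopless u v cuv = edge⇒≢ K (coloured⇒edge u v cuv)

  open Proper public

  Missing : Colouring → Fin n → Colour → Set
  Missing c v γ = ∄ λ w → c v w ≡ just γ

  present? : ∀ (c : Colouring) v γ → Dec (∃ λ w → c v w ≡ just γ)
  present? c v γ = any? (λ w → ≡-dec-Maybe _≟_ (c v w) (just γ))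

  Extends : Colouring → Colouring → Fin n → Fin n → Set
  Extends c c′ x z = ∀ u v → c′ u v ≡ nothing → c u v ≡ nothing × ¬ (u ≡ x × v ≡ z)

  Extension : Colouring → Fin n → Fin n → Set
  Extension c x z = Σ Colouring λ c′ → Proper c′ × Extends c c′ x z

  recolour : Colouring → Fin n → Fin n → Maybe Colour → Colouring
  recolour c a b m u v with ends? a b u v
  ... | yes _ = m
  ... | no _  = c u v

  module _ (c : Colouring) (a b : Fin n) (m : Maybe Colour) where

    recolour-cases : ∀ u v → (Ends a b u v × recolour c a b m u v ≡ m)
                           ⊎ (¬ Ends a b u v × recolour c a b m u v ≡ c u v)
    recolour-cases u v with ends? a b u v
    ... | yes ends = inj₁ (ends , refl)
    ... | no ¬ends = inj₂ (¬ends , refl)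

    recolour-on : ∀ {u v} → Ends a b u v → recolour c a b m u v ≡ m
    recolour-on {u} {v} ends with recolour-cases u v
    ... | inj₁ (_ , eq)     = eq
    ... | inj₂ (¬ends , _)  = ⊥-elim (¬ends ends)

    recolour-off : ∀ {u v} → ¬ Ends a b u v → recolour c a b m u v ≡ c u v
    recolour-off {u} {v} ¬ends with recolour-cases u v
    ... | inj₁ (ends , _) = ⊥-elim (¬ends ends)
    ... | inj₂ (_ , eq)   = eq

    recolour-away : ∀ {u v} → u ≢ a → u ≢ b → recolour c a b m u v ≡ c u v
    recolour-away u≢a u≢b = recolour-off λ { (inj₁ (u≡a , _)) → u≢a u≡a ; (inj₂ (u≡b , _)) → u≢b u≡b }

    recolour-missing : ∀ v {γ} → Missing c v γ → m ≢ just γ → Missing (recolour c a b m) v γ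
    recolour-missing v v-misses m≢γ (w , vw) with recolour-cases v w
    ... | inj₁ (_ , eq) = m≢γ (trans (sym eq) vw)
    ... | inj₂ (_ , eq) = v-misses (w , trans (sym eq) vw)

    recolour-missing-away : ∀ v {γ} → Missing c v γ → v ≢ a → v ≢ b → Missing (recolour c a b m) v γ
    recolour-missing-away v v-misses v≢a v≢b (w , vw) = v-misses (w , trans (sym (recolour-away v≢a v≢b)) vw)

    recolour-proper : Proper c → a ≢ b →
      (∀ {γ} → m ≡ just γ → T (adj K a b) × Missing c a γ × Missing c b γ) →
      Proper (recolour c a b m)
    recolour-proper P a≢b fits = record
      { symmetric = symmetric′ ; coloured⇒edge = coloured⇒edge′ ; injective = injective′ }
      where
      symmetric′ : ∀ u v → recolour c a b m u v ≡ recolour c a b m v u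
      symmetric′ u v with recolour-cases u v
      ... | inj₁ (ends , eq)  = trans eq (sym (recolour-on (ends-sym ends)))
      ... | inj₂ (¬ends , eq) = trans eq (trans (symmetric P u v) (sym (recolour-off (λ e → ¬ends (ends-sym e)))))
      coloured⇒edge′ : ∀ u v {γ} → recolour c a b m u v ≡ just γ → T (adj K u v)
      coloured⇒edge′ u v uv with recolour-cases u v
      ... | inj₁ (inj₁ (refl , refl) , eq) = proj₁ (fits (trans (sym eq) uv))
      ... | inj₁ (inj₂ (refl , refl) , eq) = edge-sym K (proj₁ (fits (trans (sym eq) uv)))
      ... | inj₂ (_ , eq)                  = coloured⇒edge P u v (trans (sym eq) uv)
      injective′ : ∀ u v w {γ} → recolour c a b m u v ≡ just γ → recolour c a b m u w ≡ just γ → v ≡ w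
      injective′ u v w uv uw with recolour-cases u v | recolour-cases u w
      ... | inj₁ (inj₁ (refl , refl) , _) | inj₁ (inj₁ (_ , refl) , _) = refl
      ... | inj₁ (inj₂ (refl , refl) , _) | inj₁ (inj₂ (_ , refl) , _) = refl
      ... | inj₁ (inj₁ (refl , refl) , _) | inj₁ (inj₂ (u≡b , _) , _) = ⊥-elim (a≢b u≡b)
      ... | inj₁ (inj₂ (refl , refl) , _) | inj₁ (inj₁ (u≡a , _) , _) = ⊥-elim (a≢b (sym u≡a))
      ... | inj₁ (inj₁ (refl , refl) , eq₁) | inj₂ (_ , eq₂) =
            ⊥-elim (proj₁ (proj₂ (fits (trans (sym eq₁) uv))) (w , trans (sym eq₂) uw))
      ... | inj₁ (inj₂ (refl , refl) , eq₁) | inj₂ (_ , eq₂) =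
            ⊥-elim (proj₂ (proj₂ (fits (trans (sym eq₁) uv))) (w , trans (sym eq₂) uw))
      ... | inj₂ (_ , eq₁) | inj₁ (inj₁ (refl , refl) , eq₂) =
            ⊥-elim (proj₁ (proj₂ (fits (trans (sym eq₂) uw))) (v , trans (sym eq₁) uv))
      ... | inj₂ (_ , eq₁) | inj₁ (inj₂ (refl , refl) , eq₂) =
            ⊥-elim (proj₂ (proj₂ (fits (trans (sym eq₂) uw))) (v , trans (sym eq₁) uv))
      ... | inj₂ (_ , eq₁) | inj₂ (_ , eq₂) = injective P u v w (trans (sym eq₁) uv) (trans (sym eq₂) uw)

  uncolour-frees : ∀ {c} → Proper c → ∀ {a b γ} → c a b ≡ just γ → Missing (recolour c a b nothing) a γ
  uncolour-frees {c} P {a} {b} ab (w , aw) with recolour-cases c a b nothing a w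
  ... | inj₁ (_ , eq) with () ← trans (sym eq) aw
  ... | inj₂ (¬ends , eq) = ¬ends (inj₁ (refl , sym (injective P a b w ab (trans (sym eq) aw))))

  FanStep : Colouring → Fin n → Fin n → Fin n → Set
  FanStep c x u y = ∃ λ b → c x y ≡ just b × Missing c u b

  IsFan : Colouring → Fin n → Fin n → List (Fin n) → Set
  IsFan c x u []       = ⊤
  IsFan c x u (y ∷ ys) = FanStep c x u y × IsFan c x y ys

  fanEnd : Fin n → List (Fin n) → Fin n
  fanEnd u []       = u
  fanEnd u (y ∷ ys) = fanEnd y ys

  fanEnd∈ : ∀ u ys → fanEnd u ys ∈ u ∷ ys
  fanEnd∈ u []       = here refl
  fanEnd∈ u (y ∷ ys) = there (fanEnd∈ y ys)

  fan-avoids-centre : ∀ {c} → Proper c → ∀ {x u} ys → IsFan c x u ys → ∀ {v} → v ∈ ys → x ≢ v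
  fan-avoids-centre P (y ∷ ys) ((_ , xy , _) , _) (here refl)  = loopless P _ y xy
  fan-avoids-centre P (y ∷ ys) (_ , fan)          (there v∈ys) = fan-avoids-centre P ys fan v∈ys

  fan-transport : ∀ {c c′ x u} ys → IsFan c x u ys →
    (∀ {y} → y ∈ ys → c′ x y ≡ c x y) →
    (∀ {v y b} → v ∈ u ∷ ys → y ∈ ys → c x y ≡ just b → Missing c v b → Missing c′ v b) →
    IsFan c′ x u ys
  fan-transport []       _                            _         _     = tt
  fan-transport (y ∷ ys) ((b , xy , u-misses) , fan) same-at-x keeps =
    (b , trans (same-at-x (here refl)) xy , keeps (here refl) (here refl) xy u-misses) ,
    fan-transport ys fan (λ y∈ → same-at-x (there y∈)) (λ v∈ y∈ → keeps (there v∈) (there y∈))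

  fanEnd-++ : ∀ u pre w post → fanEnd u (pre ++ w ∷ post) ≡ fanEnd w post
  fanEnd-++ u []        w post = refl
  fanEnd-++ u (y ∷ pre) w post = fanEnd-++ y pre w post

  fan-split : ∀ {c x u} pre {w post} → IsFan c x u (pre ++ w ∷ post) →
    IsFan c x u pre × FanStep c x (fanEnd u pre) w × IsFan c x w post
  fan-split []        (step , fan) = tt , step , fan
  fan-split (y ∷ pre) (step , fan) with fan-split pre fan
  ... | fan-pre , step-w , fan-post = (step , fan-pre) , step-w , fan-post

  fan-join : ∀ {c x u} pre {w post} →
    IsFan c x u pre → FanStep c x (fanEnd u pre) w → IsFan c x w post → IsFan c x u (pre ++ w ∷ post)
  fan-join []        _                step-w fan-post = step-w , fan-post
  fan-join (y ∷ pre) (step , fan-pre) step-w fan-post = step , fan-join pre fan-pre step-w fan-post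

  colour-extends : ∀ c x z γ → Extends c (recolour c x z (just γ)) x z
  colour-extends c x z γ u v uv with recolour-cases c x z (just γ) u v
  ... | inj₁ (_ , eq) with () ← trans (sym eq) uv
  ... | inj₂ (¬ends , eq) = trans (sym eq) uv , λ xz-ends → ¬ends (inj₁ xz-ends)

  shift : Colouring → Fin n → Fin n → Fin n → Colour → Colouring
  shift c x z y b = recolour (recolour c x y nothing) x z (just b)

  shift-extends : ∀ {c c′ x z y b} → Proper c′ → Extends (shift c x z y b) c′ x y → Extends c c′ x z
  shift-extends {c} {c′} {x} {z} {y} {b} P′ extends′ u v uv with extends′ u v uv
  ... | shifted-uv , ¬xy with recolour-cases (recolour c x y nothing) x z (just b) u v
  ...   | inj₁ (_ , eq) with () ← trans (sym eq) shifted-uv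
  ...   | inj₂ (¬xz , eq) with recolour-cases c x y nothing u v
  ...     | inj₁ (inj₁ xy-ends , _)       = ⊥-elim (¬xy xy-ends)
  ...     | inj₁ (inj₂ (refl , refl) , _) = ⊥-elim (proj₂ (extends′ x y (trans (symmetric P′ x y) uv)) (refl , refl))
  ...     | inj₂ (_ , eq₀)                = trans (sym eq₀) (trans (sym eq) shifted-uv) , λ xz-ends → ¬xz (inj₁ xz-ends)

  rotate : ∀ {c} → Proper c → ∀ {x z γ} ys → c x z ≡ nothing → T (adj K x z) → IsFan c x z ys →
    Unique (z ∷ ys) → Missing c x γ → Missing c (fanEnd z ys) γ → Extension c x z
  rotate {c} P {x} {z} {γ} [] xz-free xz _ _ x-misses z-misses =
    recolour c x z (just γ) ,
    recolour-proper c x z (just γ) P (edge⇒≢ K xz) (λ { refl → xz , x-misses , z-misses }) ,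
    colour-extends c x z γ
  rotate {c} P {x} {z} {γ} (y ∷ ys) xz-free xz fan@((b , xy , z-misses-b) , fanʸ) (z∉ ∷ uniqueʸ@(y∉ ∷ _))
         x-misses end-misses
    with rotate P₁ ys xy-free (coloured⇒edge P x y xy) fan₁ uniqueʸ (misses₁ x-misses) (misses₁ end-misses)
    where
    x≢y = loopless P x y xy
    x≢z = edge⇒≢ K xz
    c₀ = recolour c x y nothing
    c₁ = shift c x z y b
    P₁ : Proper c₁
    P₁ = recolour-proper c₀ x z (just b) (recolour-proper c x y nothing P x≢y λ ()) x≢z
           λ { refl → xz , uncolour-frees P xy , recolour-missing c x y nothing z z-misses-b λ () }
    xy-free : c₁ x y ≡ nothing
    xy-free = trans (recolour-off c₀ x z (just b) {x} {y}
                       λ { (inj₁ (_ , y≡z)) → All.lookup z∉ (here refl) (sym y≡z) ; (inj₂ (x≡z , _)) → x≢z x≡z })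
                    (recolour-on c x y nothing (inj₁ (refl , refl)))
    fan₁ : IsFan c₁ x y ys
    fan₁ = fan-transport ys fanʸ same-at-x keeps
      where
      same-at-x : ∀ {y′} → y′ ∈ ys → c₁ x y′ ≡ c x y′
      same-at-x {y′} y′∈ys = trans
        (recolour-off c₀ x z (just b) {x} {y′}
          λ { (inj₁ (_ , y′≡z)) → All.lookup z∉ (there y′∈ys) (sym y′≡z) ; (inj₂ (x≡z , _)) → x≢z x≡z })
        (recolour-off c x y nothing {x} {y′}
          λ { (inj₁ (_ , y′≡y)) → All.lookup y∉ y′∈ys (sym y′≡y) ; (inj₂ (x≡y , _)) → x≢y x≡y })
      keeps : ∀ {v y′ γ′} → v ∈ y ∷ ys → y′ ∈ ys → c x y′ ≡ just γ′ → Missing c v γ′ → Missing c₁ v γ′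
      keeps {v} v∈ _ _ misses = recolour-missing-away c₀ x z (just b) v (recolour-missing c x y nothing v misses λ ())
        (λ v≡x → fan-avoids-centre P (y ∷ ys) fan v∈ (sym v≡x))
        (λ v≡z → All.lookup z∉ v∈ (sym v≡z))
    misses₁ : ∀ {v} → Missing c v γ → Missing c₁ v γ
    misses₁ {v} misses = recolour-missing c₀ x z (just b) v (recolour-missing c x y nothing v misses λ ())
      λ b≡γ → x-misses (y , trans xy b≡γ)
  ... | c′ , P′ , extends′ = c′ , P′ , shift-extends P′ extends′

  module KempeChain {c : Colouring} (P : Proper c) {α β : Colour} (α≢β : α ≢ β)
                    (x : Fin n) (x-misses-α : Missing c x α) where

    neighbour : Colour → Fin n → Maybe (Fin n)
    neighbour γ v with present? c v γ
    ... | yes (w , _) = just w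
    ... | no _        = nothing

    neighbour-sound : ∀ γ v {w} → neighbour γ v ≡ just w → c v w ≡ just γ
    neighbour-sound γ v eq with present? c v γ
    neighbour-sound γ v refl | yes (_ , vw) = vw
    neighbour-sound γ v ()   | no _

    neighbour-complete : ∀ γ v {w} → c v w ≡ just γ → neighbour γ v ≡ just w
    neighbour-complete γ v {w} vw with present? c v γ
    ... | yes (w′ , vw′) = cong just (injective P v w′ w vw′ vw)
    ... | no ∄w          = ⊥-elim (∄w (w , vw))

    neighbour-missing : ∀ γ v → Missing c v γ → neighbour γ v ≡ nothing
    neighbour-missing γ v misses with present? c v γ
    ... | yes p = ⊥-elim (misses p)
    ... | no _  = refl

    colourAt : ℕ → Colour
    colourAt zero          = β
    colourAt (suc zero)    = α
    colourAt (suc (suc i)) = colourAt i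

    colourAt-cases : ∀ i → (colourAt i ≡ β × colourAt (suc i) ≡ α) ⊎ (colourAt i ≡ α × colourAt (suc i) ≡ β)
    colourAt-cases zero          = inj₁ (refl , refl)
    colourAt-cases (suc zero)    = inj₂ (refl , refl)
    colourAt-cases (suc (suc i)) = colourAt-cases i

    colourAt∈ : ∀ i → colourAt i ≡ α ⊎ colourAt i ≡ β
    colourAt∈ i with colourAt-cases i
    ... | inj₁ (i≡β , _) = inj₂ i≡β
    ... | inj₂ (i≡α , _) = inj₁ i≡α

    colourAt-other : ∀ i {γ} → γ ≡ α ⊎ γ ≡ β → γ ≢ colourAt i → γ ≡ colourAt (suc i)
    colourAt-other i γ∈ γ≢ with colourAt-cases i | γ∈
    ... | inj₁ (_ , si≡α) | inj₁ γ≡α = trans γ≡α (sym si≡α)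
    ... | inj₁ (i≡β , _)  | inj₂ γ≡β = ⊥-elim (γ≢ (trans γ≡β (sym i≡β)))
    ... | inj₂ (i≡α , _)  | inj₁ γ≡α = ⊥-elim (γ≢ (trans γ≡α (sym i≡α)))
    ... | inj₂ (_ , si≡β) | inj₂ γ≡β = trans γ≡β (sym si≡β)

    -- walk i is the i-th vertex of the path from x whose edges are coloured β, α, β, …
    walk : ℕ → Maybe (Fin n)
    walk zero    = just x
    walk (suc i) = walk i >>= neighbour (colourAt i)

    walk-step : ∀ i {v} → walk i ≡ just v → walk (suc i) ≡ neighbour (colourAt i) v
    walk-step i wi = cong (_>>= neighbour (colourAt i)) wi

    walk-back : ∀ i {u} → walk (suc i) ≡ just u → ∃ λ v → walk i ≡ just v × c v u ≡ just (colourAt i)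
    walk-back i wsi with walk i
    ... | just v  = v , refl , neighbour-sound (colourAt i) v wsi
    ... | nothing with () ← wsi

    walk-stays-nothing : ∀ {i j} → i ≤ j → walk i ≡ nothing → walk j ≡ nothing
    walk-stays-nothing i≤j = go (≤⇒≤′ i≤j)
      where
      go : ∀ {i j} → i ≤′ j → walk i ≡ nothing → walk j ≡ nothing
      go ≤′-refl                   wi = wi
      go {j = suc j} (≤′-step i≤′j) wi = cong (_>>= neighbour (colourAt j)) (go i≤′j wi)

    -- A repetition forces an earlier one: steps of equal colour into the repeated vertex come from the
    -- same vertex, and otherwise the later step retraces the step out of it.  A step back into x is a
    -- β-step (α is missing at x), so it retraces the first step.
    mutual
      no-repeat : ∀ j {i v} → i < j → walk i ≡ just v → walk j ≡ just v → ⊥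
      no-repeat (suc j) {zero} _ refl wsj with walk-back j wsj
      ... | w , wj , wx with colourAt∈ j
      ...   | inj₁ α-edge = x-misses-α (w , trans (symmetric P x w) (trans wx (cong just α-edge)))
      ...   | inj₂ β-edge = returns-by-β j wj (trans (symmetric P x w) (trans wx (cong just β-edge))) β-edge
      no-repeat (suc j) {suc i} {v} i<j wsi wsj with walk-back i wsi | walk-back j wsj
      ... | w′ , wi , w′v | w , wj , wv with colourAt j ≟ colourAt i
      ...   | yes same = no-repeat j (s≤s⁻¹ i<j) (subst (λ t → walk i ≡ just t) (sym w≡w′) wi) wj
        where
        w≡w′ : w ≡ w′
        w≡w′ = injective P v w w′ (trans (symmetric P v w) wv)
                 (trans (symmetric P v w′) (trans w′v (cong just (sym same))))
      ...   | no differ with m≤n⇒m<n∨m≡n (s≤s⁻¹ i<j)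
      ...     | inj₂ refl = loopless P w v wv (just-injective (trans (sym wj) wsi))
      ...     | inj₁ si<j with m≤n⇒m<n∨m≡n si<j
      ...       | inj₂ refl = differ refl
      ...       | inj₁ ssi<j = no-repeat j ssi<j (trans (walk-step (suc i) wsi) (neighbour-complete _ v vw)) wj
        where
        vw : c v w ≡ just (colourAt (suc i))
        vw = trans (symmetric P v w) (trans wv (cong just (colourAt-other i (colourAt∈ j) differ)))

      returns-by-β : ∀ j {w} → walk j ≡ just w → c x w ≡ just β → colourAt j ≡ β → ⊥
      returns-by-β zero          refl xx _   = loopless P x x xx refl
      returns-by-β (suc zero)    _    _  α≡β = α≢β α≡β
      returns-by-β (suc (suc j)) wj   xw _   = no-repeat (suc (suc j)) (s≤s (s≤s z≤n)) (neighbour-complete β x xw) wj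

    walk-defined : walk n ≢ nothing → ∀ (k : Fin (suc n)) → ∃ λ v → walk (toℕ k) ≡ just v
    walk-defined wn≢ k with walk (toℕ k) in wk
    ... | just v  = v , refl
    ... | nothing = ⊥-elim (wn≢ (walk-stays-nothing (toℕ≤pred[n] k) wk))

    walk-ends : walk n ≡ nothing
    walk-ends with walk n in wn
    ... | nothing = refl
    ... | just _  = ⊥-elim (long-walk-repeats λ wn≡ → case trans (sym wn) wn≡ of λ ())
      where
      long-walk-repeats : walk n ≢ nothing → ⊥
      long-walk-repeats wn≢ with pigeonhole (n<1+n n) (λ k → proj₁ (walk-defined wn≢ k))
      ... | i , j , i<j , same = no-repeat (toℕ j) i<j (proj₂ (walk-defined wn≢ i))
                                   (subst (λ t → walk (toℕ j) ≡ just t) (sym same) (proj₂ (walk-defined wn≢ j)))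

    walk-bound : ∀ i {v} → walk i ≡ just v → i < n
    walk-bound i wi with i <? n
    ... | yes i<n = i<n
    ... | no  i≮n with () ← trans (sym wi) (walk-stays-nothing (≮⇒≥ i≮n) walk-ends)

    OnPath : Fin n → Set
    OnPath v = ∃ λ (i : Fin n) → walk (toℕ i) ≡ just v

    onPath? : ∀ v → Dec (OnPath v)
    onPath? v = any? (λ i → ≡-dec-Maybe _≟_ (walk (toℕ i)) (just v))

    onPath : ∀ i {v} → walk i ≡ just v → OnPath v
    onPath i {v} wi = fromℕ< (walk-bound i wi) , subst (λ k → walk k ≡ just v) (sym (toℕ-fromℕ< (walk-bound i wi))) wi

    x-onPath : OnPath x
    x-onPath = onPath 0 refl

    path-closed : ∀ {v u γ} → OnPath v → c v u ≡ just γ → γ ≡ α ⊎ γ ≡ β → OnPath u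
    path-closed {v} {u} {γ} (i , wi) vu γ∈ with γ ≟ colourAt (toℕ i)
    ... | yes refl = onPath (suc (toℕ i)) (trans (walk-step (toℕ i) wi) (neighbour-complete _ v vu))
    ... | no  γ≢   = via-predecessor (toℕ i) wi γ≢
      where
      via-predecessor : ∀ i → walk i ≡ just v → γ ≢ colourAt i → OnPath u
      via-predecessor zero    wi γ≢β with colourAt-other 0 γ∈ γ≢β
      ... | refl = ⊥-elim (x-misses-α (u , subst (λ t → c t u ≡ just α) (sym (just-injective wi)) vu))
      via-predecessor (suc i) wi γ≢ with walk-back i wi
      ... | w , wi-w , wv = onPath i (subst (λ t → walk i ≡ just t) (injective P v w u vw vu) wi-w)
        where
        vw : c v w ≡ just γ
        vw = trans (symmetric P v w) (trans wv (cong just (sym (colourAt-other (suc i) γ∈ γ≢))))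

    path-ends-at : ∀ i {u} → walk i ≡ just u → u ≢ x → Missing c u β → walk (suc i) ≡ nothing
    path-ends-at zero    refl u≢x _ = ⊥-elim (u≢x refl)
    path-ends-at (suc i) {u} wsi _ u-misses-β with walk-back i wsi
    ... | w , _ , wu with colourAt-cases i
    ...   | inj₁ (i≡β , _)  = ⊥-elim (u-misses-β (w , trans (symmetric P u w) (trans wu (cong just i≡β))))
    ...   | inj₂ (_ , si≡β) = trans (walk-step (suc i) wsi)
                                (trans (cong (λ γ → neighbour γ u) si≡β) (neighbour-missing β u u-misses-β))

    one-far-end : ∀ {u t} → OnPath u → OnPath t → u ≢ x → t ≢ x → Missing c u β → Missing c t β → u ≡ t
    one-far-end (i , wi) (j , wj) u≢x t≢x u-misses t-misses with <-cmp (toℕ i) (toℕ j)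
    ... | tri≈ _ i≡j _ = just-injective (trans (sym wi) (trans (cong walk i≡j) wj))
    ... | tri< i<j _ _ with () ← trans (sym wj) (walk-stays-nothing i<j (path-ends-at (toℕ i) wi u≢x u-misses))
    ... | tri> _ _ j<i with () ← trans (sym wi) (walk-stays-nothing j<i (path-ends-at (toℕ j) wj t≢x t-misses))

    exchange : Colour → Colour
    exchange γ with γ ≟ α | γ ≟ β
    ... | yes _ | _     = β
    ... | no _  | yes _ = α
    ... | no _  | no _  = γ

    exchange-α : exchange α ≡ β
    exchange-α with α ≟ α
    ... | yes _  = refl
    ... | no α≢α = ⊥-elim (α≢α refl)

    exchange-β : exchange β ≡ α
    exchange-β with β ≟ α | β ≟ β
    ... | yes β≡α | _     = ⊥-elim (α≢β (sym β≡α))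
    ... | no _    | yes _ = refl
    ... | no _    | no β≢β = ⊥-elim (β≢β refl)

    exchange-cases : ∀ γ → (γ ≡ α ⊎ γ ≡ β) ⊎ exchange γ ≡ γ
    exchange-cases γ with γ ≟ α | γ ≟ β
    ... | yes γ≡α | _       = inj₁ (inj₁ γ≡α)
    ... | no _    | yes γ≡β = inj₁ (inj₂ γ≡β)
    ... | no _    | no _    = inj₂ refl

    exchange-involutive : ∀ γ → exchange (exchange γ) ≡ γ
    exchange-involutive γ with exchange-cases γ
    ... | inj₁ (inj₁ refl) = trans (cong exchange exchange-α) exchange-β
    ... | inj₁ (inj₂ refl) = trans (cong exchange exchange-β) exchange-α
    ... | inj₂ fixed       = trans (cong exchange fixed) fixed

    map-exchange-just : ∀ {m γ} → Maybe.map exchange m ≡ just γ → m ≡ just (exchange γ)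
    map-exchange-just {just δ} refl = cong just (sym (exchange-involutive δ))

    map-exchange-nothing : ∀ {m} → Maybe.map exchange m ≡ nothing → m ≡ nothing
    map-exchange-nothing {nothing} _ = refl

    -- Exchanging α and β at the vertices off the path is the Kempe swap of the path followed by a
    -- global renaming of α and β; unlike the swap itself it keeps every colour at x.
    swapped : Colouring
    swapped u v with onPath? u
    ... | yes _ = c u v
    ... | no _  = Maybe.map exchange (c u v)

    swapped-cases : ∀ u v → (OnPath u × swapped u v ≡ c u v) ⊎ (¬ OnPath u × swapped u v ≡ Maybe.map exchange (c u v))
    swapped-cases u v with onPath? u
    ... | yes on = inj₁ (on , refl)
    ... | no off = inj₂ (off , refl)

    swapped-on : ∀ {u} v → OnPath u → swapped u v ≡ c u v
    swapped-on {u} v on with swapped-cases u v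
    ... | inj₁ (_ , eq)   = eq
    ... | inj₂ (off , _)  = ⊥-elim (off on)

    swapped-nothing : ∀ u v → swapped u v ≡ nothing → c u v ≡ nothing
    swapped-nothing u v uv with swapped-cases u v
    ... | inj₁ (_ , eq) = trans (sym eq) uv
    ... | inj₂ (_ , eq) = map-exchange-nothing (trans (sym eq) uv)

    crossing : ∀ u v → OnPath u → ¬ OnPath v → c u v ≡ Maybe.map exchange (c v u)
    crossing u v on off with c u v in uv
    ... | nothing = cong (Maybe.map exchange) (sym (trans (symmetric P v u) uv))
    ... | just γ with exchange-cases γ
    ...   | inj₁ γ∈ = ⊥-elim (off (path-closed on uv γ∈))
    ...   | inj₂ fixed rewrite trans (symmetric P v u) uv = cong just (sym fixed)

    swapped-proper : Proper swapped
    swapped-proper = record { symmetric = symmetric′ ; coloured⇒edge = coloured⇒edge′ ; injective = injective′ }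
      where
      symmetric′ : ∀ u v → swapped u v ≡ swapped v u
      symmetric′ u v with swapped-cases u v | swapped-cases v u
      ... | inj₁ (_ , eq₁)     | inj₁ (_ , eq₂)    = trans eq₁ (trans (symmetric P u v) (sym eq₂))
      ... | inj₂ (_ , eq₁)     | inj₂ (_ , eq₂)    =
            trans eq₁ (trans (cong (Maybe.map exchange) (symmetric P u v)) (sym eq₂))
      ... | inj₁ (on , eq₁)    | inj₂ (off , eq₂)  = trans eq₁ (trans (crossing u v on off) (sym eq₂))
      ... | inj₂ (off , eq₁)   | inj₁ (on , eq₂)   = trans eq₁ (trans (sym (crossing v u on off)) (sym eq₂))
      coloured⇒edge′ : ∀ u v {γ} → swapped u v ≡ just γ → T (adj K u v)
      coloured⇒edge′ u v uv with swapped-cases u v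
      ... | inj₁ (_ , eq) = coloured⇒edge P u v (trans (sym eq) uv)
      ... | inj₂ (_ , eq) = coloured⇒edge P u v (map-exchange-just (trans (sym eq) uv))
      injective′ : ∀ u v w {γ} → swapped u v ≡ just γ → swapped u w ≡ just γ → v ≡ w
      injective′ u v w uv uw with swapped-cases u v | swapped-cases u w
      ... | inj₁ (_ , eq₁)  | inj₁ (_ , eq₂)  = injective P u v w (trans (sym eq₁) uv) (trans (sym eq₂) uw)
      ... | inj₂ (_ , eq₁)  | inj₂ (_ , eq₂)  =
            injective P u v w (map-exchange-just (trans (sym eq₁) uv)) (map-exchange-just (trans (sym eq₂) uw))
      ... | inj₁ (on , _)   | inj₂ (off , _)  = ⊥-elim (off on)
      ... | inj₂ (off , _)  | inj₁ (on , _)   = ⊥-elim (off on)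

    missing-on : ∀ {v γ} → OnPath v → Missing c v γ → Missing swapped v γ
    missing-on {v} on misses (w , vw) = misses (w , trans (sym (swapped-on w on)) vw)

    missing-fixed : ∀ {v γ} → exchange γ ≡ γ → Missing c v γ → Missing swapped v γ
    missing-fixed {v} fixed misses (w , vw) with swapped-cases v w
    ... | inj₁ (_ , eq) = misses (w , trans (sym eq) vw)
    ... | inj₂ (_ , eq) = misses (w , trans (map-exchange-just (trans (sym eq) vw)) (cong just fixed))

    missing-off : ∀ {v γ} → ¬ OnPath v → Missing c v (exchange γ) → Missing swapped v γ
    missing-off {v} off misses (w , vw) with swapped-cases v w
    ... | inj₁ (on , _) = off on
    ... | inj₂ (_ , eq) = misses (w , map-exchange-just (trans (sym eq) vw))

  _hasColour_ : Maybe Colour → Colour → Bool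
  nothing hasColour γ = false
  just δ  hasColour γ = ⌊ δ ≟ γ ⌋

  hasColour⇒≡ : ∀ m {γ} → T (m hasColour γ) → m ≡ just γ
  hasColour⇒≡ (just δ) {γ} has with δ ≟ γ
  ... | yes refl = refl

  ≡⇒hasColour : ∀ {m γ} → m ≡ just γ → T (m hasColour γ)
  ≡⇒hasColour {γ = γ} refl with γ ≟ γ
  ... | yes _  = _
  ... | no γ≢γ = γ≢γ refl

  ∑-hasColour : ∀ m → ∑[ γ < suc d ] χ (m hasColour γ) ≡ χ (is-just m)
  ∑-hasColour nothing  = sum-replicate-zero (suc d)
  ∑-hasColour (just δ) = ∑χ≟≡1 δ

  colours-at : ∀ (c : Colouring) v → ∑[ γ < suc d ] ∑[ w < n ] χ (c v w hasColour γ) ≡ ∑[ w < n ] χ (is-just (c v w))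
  colours-at c v = trans (∑-comm (λ γ w → χ (c v w hasColour γ))) (sum-cong-≗ (λ w → ∑-hasColour (c v w)))

  χ-coloured≤χ-adj : ∀ {c} → Proper c → ∀ v w → χ (is-just (c v w)) ≤ χ (adj K v w)
  χ-coloured≤χ-adj {c} P v w with c v w in vw
  ... | nothing = z≤n
  ... | just _  = T⇒1≤χ (coloured⇒edge P v w vw)

  Total : Colouring → Set
  Total c = ∀ u v → T (adj K u v) → c u v ≢ nothing

  χ-coloured≡χ-adj : ∀ {c} → Proper c → Total c → ∀ v w → χ (is-just (c v w)) ≡ χ (adj K v w)
  χ-coloured≡χ-adj {c} P total v w with c v w in vw | adj K v w in vw-edge
  ... | nothing | false = refl
  ... | nothing | true  = ⊥-elim (total v w (subst T (sym vw-edge) _) vw)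
  ... | just _  | true  = refl
  ... | just _  | false = ⊥-elim (subst T vw-edge (coloured⇒edge P v w vw))

  extends-back : ∀ {c c₁ x z} → (∀ u v → c₁ u v ≡ nothing → c u v ≡ nothing) →
    Extension c₁ x z → Extension c x z
  extends-back back (c′ , P′ , extends) =
    c′ , P′ , λ u v free → back u v (proj₁ (extends u v free)) , proj₂ (extends u v free)

  module _ (deg≤d : ∀ v → deg K v ≤ d) where

    missing-colour : ∀ {c} → Proper c → ∀ v → ∃ (Missing c v)
    missing-colour {c} P v with any? (λ γ → ¬? (present? c v γ))
    ... | yes found = found
    ... | no none   = ⊥-elim (<⇒≱ (s≤s (deg≤d v)) (begin
      suc d                                              ≡⟨ sym (∑-ones (suc d)) ⟩
      ∑[ γ < suc d ] 1                                   ≤⟨ ∑-mono-≤ present ⟩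
      ∑[ γ < suc d ] ∑[ w < n ] χ (c v w hasColour γ)    ≡⟨ colours-at c v ⟩
      ∑[ w < n ] χ (is-just (c v w))                     ≤⟨ ∑-mono-≤ (χ-coloured≤χ-adj P v) ⟩
      ∑[ w < n ] χ (adj K v w)                           ≡⟨ sym (deg≡∑χ K v) ⟩
      deg K v                                            ∎))
      where
      open ≤-Reasoning
      present : ∀ γ → 1 ≤ ∑[ w < n ] χ (c v w hasColour γ)
      present γ with present? c v γ
      ... | yes (w , vw) = ≤-trans (T⇒1≤χ (≡⇒hasColour vw)) (term≤∑ (λ w → χ (c v w hasColour γ)) w)
      ... | no absent    = ⊥-elim (none (γ , absent))

    module Extend {c} (P : Proper c) {x z} (xz-free : c x z ≡ nothing) (xz : T (adj K x z)) where

      α : Colour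
      α = proj₁ (missing-colour P x)

      x-misses-α : Missing c x α
      x-misses-α = proj₂ (missing-colour P x)

      fan-vertex≢x : ∀ {u ys} → x ≢ u → IsFan c x u ys → ∀ {v} → v ∈ u ∷ ys → v ≢ x
      fan-vertex≢x x≢u _   (here refl) v≡x = x≢u (sym v≡x)
      fan-vertex≢x _   fan (there v∈)  v≡x = fan-avoids-centre P _ fan v∈ (sym v≡x)

      -- Both u (before w) and t (the end of the fan) miss bt.  The α/bt path from x ends in at most
      -- one of them, so after exchanging α and bt off that path, α is missing at u or at t and the
      -- fan up to that vertex can be rotated.
      module Kempe pre {w post bt} (fan : IsFan c x z (pre ++ w ∷ post)) (unique : Unique (z ∷ pre ++ w ∷ post))
                   (xw : c x w ≡ just bt) (end-misses : Missing c (fanEnd z (pre ++ w ∷ post)) bt) where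

        u = fanEnd z pre
        t = fanEnd w post

        fan-pre : IsFan c x z pre
        fan-pre = proj₁ (fan-split pre fan)

        fan-post : IsFan c x w post
        fan-post = proj₂ (proj₂ (fan-split pre fan))

        u-misses : Missing c u bt
        u-misses with proj₁ (proj₂ (fan-split pre fan))
        ... | b , xw′ , u-misses-b rewrite just-injective (trans (sym xw′) xw) = u-misses-b

        t-misses : Missing c t bt
        t-misses = subst (λ v → Missing c v bt) (fanEnd-++ z pre w post) end-misses

        parts = unique-++⁻ (z ∷ pre) unique

        pre∌w : ∀ {y} → y ∈ pre → y ≢ w
        pre∌w y∈ = proj₂ (proj₂ parts) (there y∈) (here refl)

        post∌w : ∀ {y} → y ∈ post → y ≢ w
        post∌w y∈ y≡w with proj₁ (proj₂ parts)
        ... | w∉ ∷ _ = All.lookup w∉ y∈ (sym y≡w)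

        α≢bt : α ≢ bt
        α≢bt α≡bt = x-misses-α (w , trans xw (cong just (sym α≡bt)))

        open KempeChain P α≢bt x x-misses-α

        swap-keeps-fan : ∀ {r} ys → IsFan c x r ys → (∀ {y} → y ∈ ys → y ≢ w) → IsFan swapped x r ys
        swap-keeps-fan ys fan-ys ∌w = fan-transport ys fan-ys (λ {y} _ → swapped-on y x-onPath) keeps
          where
          keeps : ∀ {v y b} → v ∈ _ → y ∈ ys → c x y ≡ just b → Missing c v b → Missing swapped v b
          keeps {v} {y} {b} _ y∈ xy misses with exchange-cases b
          ... | inj₂ fixed       = missing-fixed fixed misses
          ... | inj₁ (inj₁ refl) = ⊥-elim (x-misses-α (y , xy))
          ... | inj₁ (inj₂ refl) = ⊥-elim (∌w y∈ (injective P x y w xy xw))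

        misses-α-after-swap : ∀ {v} → ¬ OnPath v → Missing c v bt → Missing swapped v α
        misses-α-after-swap off misses = missing-off off (subst (Missing c _) (sym exchange-α) misses)

        xz-free′ : swapped x z ≡ nothing
        xz-free′ = trans (swapped-on z x-onPath) xz-free

        t-off : OnPath u → ¬ OnPath t
        t-off u-on t-on = proj₂ (proj₂ parts) (fanEnd∈ z pre) (fanEnd∈ w post)
          (one-far-end u-on t-on (fan-vertex≢x (edge⇒≢ K xz) fan-pre (fanEnd∈ z pre))
            (fan-vertex≢x (loopless P x w xw) fan-post (fanEnd∈ w post)) u-misses t-misses)

        rotate-after-swap : Dec (OnPath u) → Extension swapped x z
        rotate-after-swap (no u-off) = rotate swapped-proper pre xz-free′ xz (swap-keeps-fan pre fan-pre pre∌w)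
          (proj₁ parts) (missing-on x-onPath x-misses-α) (misses-α-after-swap u-off u-misses)
        rotate-after-swap (yes u-on) = rotate swapped-proper (pre ++ w ∷ post) xz-free′ xz
          (fan-join pre (swap-keeps-fan pre fan-pre pre∌w)
            (bt , trans (swapped-on w x-onPath) xw , missing-on u-on u-misses)
            (swap-keeps-fan post fan-post post∌w))
          unique (missing-on x-onPath x-misses-α)
          (subst (λ v → Missing swapped v α) (sym (fanEnd-++ z pre w post)) (misses-α-after-swap (t-off u-on) t-misses))

        extension : Extension c x z
        extension = extends-back swapped-nothing (rotate-after-swap (onPath? u))

      -- The fan has distinct vertices, so it cannot grow more than n times.
      search : ∀ fuel ys → IsFan c x z ys → Unique (z ∷ ys) → n < length (z ∷ ys) + fuel → Extension c x z
      search zero ys _ unique bound =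
        ⊥-elim (<⇒≱ (subst (n <_) (+-identityʳ _) bound) (unique-length≤ unique))
      search (suc fuel) ys fan unique bound with missing-colour P (fanEnd z ys)
      ... | bt , t-misses with present? c x bt
      ...   | no x-misses-bt = rotate P ys xz-free xz fan unique x-misses-bt t-misses
      ...   | yes (w , xw) with w ∈? (z ∷ ys)
      ...     | yes (here refl)  with () ← trans (sym xz-free) xw
      ...     | yes (there w∈ys) with ∈-∃++ w∈ys
      ...       | pre , post , refl = Kempe.extension pre fan unique xw t-misses
      search (suc fuel) ys fan unique bound
              | bt , t-misses | yes (w , xw) | no w∉ =
        search fuel (ys ++ [ w ]) (fan-join ys fan (bt , xw , t-misses) tt) (unique-snoc unique w∉)
          (subst (n <_) (sym longer) bound)
        where
        longer : length (z ∷ ys ++ [ w ]) + fuel ≡ length (z ∷ ys) + suc fuel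
        longer = cong suc (trans (cong (_+ fuel) (length-++ ys)) (+-assoc (length ys) 1 fuel))

      extension : Extension c x z
      extension = search n [] tt ([] ∷ []) (n<1+n n)

    Listed : Colouring → List (Fin n × Fin n) → Set
    Listed c pairs = ∀ u v → c u v ≡ nothing → T (adj K u v) → (u , v) ∈ pairs

    listed-tail : ∀ {c a b pairs} → Listed c ((a , b) ∷ pairs) →
      (∀ u v → c u v ≡ nothing → T (adj K u v) → ¬ (u ≡ a × v ≡ b)) → Listed c pairs
    listed-tail listed not-head u v free uv with listed u v free uv
    ... | here refl = ⊥-elim (not-head u v free uv (refl , refl))
    ... | there p   = p

    colour-listed : ∀ pairs {c} → Proper c → Listed c pairs → ∃ λ c′ → Proper c′ × Total c′
    colour-listed [] P listed = _ , P , λ u v uv free → case listed u v free uv of λ ()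
    colour-listed ((a , b) ∷ pairs) {c} P listed with c a b in ab | T? (adj K a b)
    ... | just _  | _ =
      colour-listed pairs P (listed-tail listed λ { u v free _ (refl , refl) → case trans (sym ab) free of λ () })
    ... | nothing | no ¬ab-edge = colour-listed pairs P (listed-tail listed λ { u v _ uv (refl , refl) → ¬ab-edge uv })
    ... | nothing | yes ab-edge with Extend.extension P ab ab-edge
    ...   | c′ , P′ , extends = colour-listed pairs P′
            (listed-tail (λ u v free′ → listed u v (proj₁ (extends u v free′)))
                         (λ u v free′ _ → proj₂ (extends u v free′)))

    vizing : ∃ λ c → Proper c × Total c
    vizing = colour-listed (cartesianProduct (allFin n) (allFin n)) uncoloured-proper
               (λ u v _ _ → ∈-cartesianProduct⁺ (∈-allFin u) (∈-allFin v))
      where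
      uncoloured-proper : Proper (λ _ _ → nothing)
      uncoloured-proper = record { symmetric = λ _ _ → refl ; coloured⇒edge = λ _ _ () ; injective = λ _ _ _ () }

  colourClass : ∀ {c} → Proper c → Colour → Graph n
  colourClass {c} P γ = record
    { adj    = λ u v → c u v hasColour γ
    ; sym    = λ u v → cong (_hasColour γ) (symmetric P u v)
    ; irrefl = no-loop
    }
    where
    no-loop : ∀ u → c u u hasColour γ ≡ false
    no-loop u with c u u in uu
    ... | nothing = refl
    ... | just _  = ⊥-elim (loopless P u u uu refl)

  colourClass-matching : ∀ {c} (P : Proper c) γ → IsMatching K (colourClass P γ)
  colourClass-matching {c} P γ =
    (λ u v uv → coloured⇒edge P u v (hasColour⇒≡ (c u v) uv)) ,
    (λ v → Equivalence.from (deg≤1⇔atMostOne (colourClass P γ) v)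
             (λ w w′ vw vw′ → injective P v w w′ (hasColour⇒≡ (c v w) vw) (hasColour⇒≡ (c v w′) vw′)))

  ∑-colourClass-deg : ∀ {c} (P : Proper c) → Total c → ∀ v →
    ∑[ γ < suc d ] deg (colourClass P γ) v ≡ deg K v
  ∑-colourClass-deg {c} P total v = begin
    ∑[ γ < suc d ] deg (colourClass P γ) v
      ≡⟨ sum-cong-≗ (λ γ → count≡∑χ (λ w → c v w hasColour γ)) ⟩
    ∑[ γ < suc d ] ∑[ w < n ] χ (c v w hasColour γ)  ≡⟨ colours-at c v ⟩
    ∑[ w < n ] χ (is-just (c v w))                   ≡⟨ sum-cong-≗ (χ-coloured≡χ-adj P total v) ⟩
    ∑[ w < n ] χ (adj K v w)                         ≡⟨ sym (deg≡∑χ K v) ⟩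
    deg K v                                          ∎
    where open ≡-Reasoning

  matching-covering : (∀ v → deg K v ≤ d) → ∀ (h : Fin n → Bool) → ∃ λ M → IsMatching K M ×
    ∑[ v < n ] (if h v then deg K v else 0) ≤ suc d * count (λ v → h v ∧ matchedᵇ M v)
  matching-covering deg≤d h with vizing deg≤d
  ... | c , P , total with ∑≤size*largest (λ γ → count (λ v → h v ∧ matchedᵇ (colourClass P γ) v))
  ...   | γ , largest = colourClass P γ , colourClass-matching P γ ,
                        subst (_≤ suc d * count (λ v → h v ∧ matchedᵇ (colourClass P γ) v)) ∑-classes largest
    where
    open ≡-Reasoning
    at : ∀ v → ∑[ γ < suc d ] χ (h v ∧ matchedᵇ (colourClass P γ) v) ≡ (if h v then deg K v else 0)
    at v with h v
    ... | false = sum-replicate-zero (suc d)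
    ... | true  = trans (sum-cong-≗ (λ γ → χ-matched≡deg (colourClass P γ) v (proj₂ (colourClass-matching P γ) v)))
                        (∑-colourClass-deg P total v)
    ∑-classes : ∑[ γ < suc d ] count (λ v → h v ∧ matchedᵇ (colourClass P γ) v)
              ≡ ∑[ v < n ] (if h v then deg K v else 0)
    ∑-classes = begin
      ∑[ γ < suc d ] count (λ v → h v ∧ matchedᵇ (colourClass P γ) v)
        ≡⟨ sum-cong-≗ (λ γ → count≡∑χ (λ v → h v ∧ matchedᵇ (colourClass P γ) v)) ⟩
      ∑[ γ < suc d ] ∑[ v < n ] χ (h v ∧ matchedᵇ (colourClass P γ) v)
        ≡⟨ ∑-comm (λ γ v → χ (h v ∧ matchedᵇ (colourClass P γ) v)) ⟩
      ∑[ v < n ] ∑[ γ < suc d ] χ (h v ∧ matchedᵇ (colourClass P γ) v)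
        ≡⟨ sum-cong-≗ at ⟩
      ∑[ v < n ] (if h v then deg K v else 0) ∎

module NatEmbedding where

  open import Data.Nat as ℕ using (ℕ; zero; suc; z≤n)
  open import Data.Nat.Coprimality using (Coprime; 1-coprimeTo)
  import Data.Nat.Coprimality as Coprime
  open import Data.Integer as ℤ using (+_; +≤+)
  import Data.Integer.Properties as ℤ
  open import Data.Rational using (mkℚ; _/_; 0ℚ; _≤_; _+_; _*_; *≤*; Positive)
  open import Data.Rational.Properties
    using (normalize-coprime; ≤-reflexive; ≤-trans; +-mono-≤; *-zeroʳ; *-identityʳ; *-distribˡ-+; module ≤-Reasoning)
  open import Data.Bool using (Bool; true; false; if_then_else_; T)
  open import Data.Fin using (Fin; zero; suc)
  open import Function using (_∘_)
  open import Relation.Binary.PropositionalEquality using (_≡_; cong; cong₂; sym; subst)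
  open import Defs using (ℕ→ℚ; count)
  open Counting

  ℕ→ℚ≡mkℚ : ∀ k → ℕ→ℚ k ≡ mkℚ (+ k) 0 (Coprime.sym (1-coprimeTo k))
  ℕ→ℚ≡mkℚ k = normalize-coprime _

  ℕ→ℚ-+ : ∀ a b → ℕ→ℚ (a ℕ.+ b) ≡ ℕ→ℚ a + ℕ→ℚ b
  ℕ→ℚ-+ a b rewrite ℕ→ℚ≡mkℚ a | ℕ→ℚ≡mkℚ b =
    cong (_/ 1) (sym (cong₂ ℤ._+_ (ℤ.*-identityʳ (+ a)) (ℤ.*-identityʳ (+ b))))

  ℕ→ℚ-* : ∀ a b → ℕ→ℚ (a ℕ.* b) ≡ ℕ→ℚ a * ℕ→ℚ b
  ℕ→ℚ-* a b rewrite ℕ→ℚ≡mkℚ a | ℕ→ℚ≡mkℚ b = cong (_/ 1) (ℤ.pos-* a b)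

  ℕ→ℚ-mono-≤ : ∀ {a b} → a ℕ.≤ b → ℕ→ℚ a ≤ ℕ→ℚ b
  ℕ→ℚ-mono-≤ {a} {b} a≤b rewrite ℕ→ℚ≡mkℚ a | ℕ→ℚ≡mkℚ b =
    *≤* (ℤ.*-monoʳ-≤-nonNeg (+ 1) (+≤+ a≤b))

  ℕ→ℚ-nonNeg : ∀ k → 0ℚ ≤ ℕ→ℚ k
  ℕ→ℚ-nonNeg k = ℕ→ℚ-mono-≤ {0} {k} z≤n

  ℕ→ℚ-suc-pos : ∀ k → Positive (ℕ→ℚ (suc k))
  ℕ→ℚ-suc-pos k rewrite ℕ→ℚ≡mkℚ (suc k) = _

  *∑χ≤∑ : ∀ {n} (h : Fin n → Bool) (f : Fin n → ℕ) {θ} → (∀ v → T (h v) → θ ≤ ℕ→ℚ (f v)) →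
    θ * ℕ→ℚ (∑[ v < n ] χ (h v)) ≤ ℕ→ℚ (∑[ v < n ] (if h v then f v else 0))
  *∑χ≤∑ {zero}  h f {θ} _ = ≤-reflexive (*-zeroʳ θ)
  *∑χ≤∑ {suc n} h f {θ} bound = begin
    θ * ℕ→ℚ (χ (h zero) ℕ.+ ∑χ)                       ≡⟨ cong (θ *_) (ℕ→ℚ-+ (χ (h zero)) ∑χ) ⟩
    θ * (ℕ→ℚ (χ (h zero)) + ℕ→ℚ ∑χ)                   ≡⟨ *-distribˡ-+ θ (ℕ→ℚ (χ (h zero))) (ℕ→ℚ ∑χ) ⟩
    θ * ℕ→ℚ (χ (h zero)) + θ * ℕ→ℚ ∑χ                 ≤⟨ +-mono-≤ (head (h zero) (bound zero))
                                                            (*∑χ≤∑ (h ∘ suc) (f ∘ suc) (bound ∘ suc)) ⟩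
    ℕ→ℚ (if h zero then f zero else 0) + ℕ→ℚ ∑f      ≡⟨ sym (ℕ→ℚ-+ (if h zero then f zero else 0) ∑f) ⟩
    ℕ→ℚ ((if h zero then f zero else 0) ℕ.+ ∑f)      ∎
    where
    open ≤-Reasoning
    ∑χ = ∑[ v < n ] χ (h (suc v))
    ∑f = ∑[ v < n ] (if h (suc v) then f (suc v) else 0)
    head : ∀ b → (T b → θ ≤ ℕ→ℚ (f zero)) → θ * ℕ→ℚ (χ b) ≤ ℕ→ℚ (if b then f zero else 0)
    head true  θ≤ = ≤-trans (≤-reflexive (*-identityʳ θ)) (θ≤ _)
    head false _  = ≤-reflexive (*-zeroʳ θ)

  *count≤∑ : ∀ {n} (h : Fin n → Bool) (f : Fin n → ℕ) {θ} → (∀ v → T (h v) → θ ≤ ℕ→ℚ (f v)) →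
    θ * ℕ→ℚ (count h) ≤ ℕ→ℚ (∑[ v < n ] (if h v then f v else 0))
  *count≤∑ {n} h f {θ} bound =
    subst (λ k → θ * ℕ→ℚ k ≤ ℕ→ℚ (∑[ v < n ] (if h v then f v else 0)))
          (sym (count≡∑χ h)) (*∑χ≤∑ h f bound)

module KernelArithmetic where

  open import Data.Nat using (suc)
  open import Data.Integer using (+_)
  open import Data.Rational using (ℚ; _/_; 0ℚ; 1ℚ; _+_; _-_; _*_; -_; _≤_; _<_; nonNegative)
  open import Data.Rational.Properties
    using (≤-trans; <⇒≤; +-mono-≤; +-monoʳ-≤; +-monoˡ-≤; +-identityʳ; +-inverseʳ;
           *-assoc; *-monoʳ-≤-nonNeg; *-monoˡ-≤-nonNeg; *-cancelˡ-≤-pos; *-zeroʳ; neg-antimono-≤;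
           module ≤-Reasoning)
  open import Data.Rational.Solver using (module +-*-Solver)
  open +-*-Solver
  open import Relation.Binary.PropositionalEquality using (_≡_; refl; sym; cong; subst)
  open import Defs using (ℕ→ℚ)
  open NatEmbedding

  two four : ℚ
  two  = + 2 / 1
  four = + 4 / 1

  x≤x+y : ∀ {x y} → 0ℚ ≤ y → x ≤ x + y
  x≤x+y {x} {y} 0≤y = subst (_≤ x + y) (+-identityʳ x) (+-monoʳ-≤ x 0≤y)

  0≤y-x : ∀ {x y} → x ≤ y → 0ℚ ≤ y - x
  0≤y-x {x} {y} x≤y = subst (_≤ y - x) (+-inverseʳ x) (+-monoˡ-≤ (- x) x≤y)

  *-monoˡ-≤-0≤ : ∀ {r p q} → 0ℚ ≤ r → p ≤ q → r * p ≤ r * q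
  *-monoˡ-≤-0≤ {r} 0≤r = *-monoˡ-≤-nonNeg r {{nonNegative 0≤r}}

  *-monoʳ-≤-0≤ : ∀ {r p q} → 0ℚ ≤ r → p ≤ q → p * r ≤ q * r
  *-monoʳ-≤-0≤ {r} 0≤r = *-monoʳ-≤-nonNeg r {{nonNegative 0≤r}}

  0≤* : ∀ {p q} → 0ℚ ≤ p → 0ℚ ≤ q → 0ℚ ≤ p * q
  0≤* {p} {q} 0≤p 0≤q = subst (_≤ p * q) (*-zeroʳ p) (*-monoˡ-≤-0≤ 0≤p 0≤q)

  -- (d + 1)(1 - 2ε) + ((dε - 1) + 2ε) = d(1 - ε), and the bracket is non-negative when dε ≥ 1.
  kernel-coefficient : ∀ d {ε} → 0ℚ ≤ ε → 1ℚ ≤ ℕ→ℚ d * ε →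
    ℕ→ℚ (suc d) * (1ℚ - two * ε) ≤ ℕ→ℚ d * (1ℚ - ε)
  kernel-coefficient d {ε} 0≤ε 1≤dε =
    subst (_≤ ℕ→ℚ d * (1ℚ - ε)) (cong (_* (1ℚ - two * ε)) (sym (ℕ→ℚ-+ 1 d)))
      (subst ((1ℚ + ℕ→ℚ d) * (1ℚ - two * ε) ≤_) identity (x≤x+y bracket≥0))
    where
    bracket≥0 : 0ℚ ≤ (ℕ→ℚ d * ε - 1ℚ) + two * ε
    bracket≥0 = subst (_≤ (ℕ→ℚ d * ε - 1ℚ) + two * ε) (+-identityʳ 0ℚ)
                  (+-mono-≤ (0≤y-x 1≤dε) (0≤* (ℕ→ℚ-nonNeg 2) 0≤ε))
    identity : (1ℚ + ℕ→ℚ d) * (1ℚ - two * ε) + ((ℕ→ℚ d * ε - 1ℚ) + two * ε) ≡ ℕ→ℚ d * (1ℚ - ε)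
    identity = solve 2 (λ D e → (con 1ℚ :+ D) :* (con 1ℚ :- con two :* e) :+ ((D :* e :- con 1ℚ) :+ con two :* e)
                              := D :* (con 1ℚ :- e)) refl (ℕ→ℚ d) ε

  covered-fraction : ∀ d {ε h m} → 0ℚ ≤ ε → 1ℚ ≤ ℕ→ℚ d * ε → 0ℚ ≤ h →
    ℕ→ℚ d * (1ℚ - ε) * h ≤ ℕ→ℚ (suc d) * m → (1ℚ - two * ε) * h ≤ m
  covered-fraction d {ε} {h} {m} 0≤ε 1≤dε 0≤h degrees = *-cancelˡ-≤-pos (ℕ→ℚ (suc d)) {{ℕ→ℚ-suc-pos d}} (begin
    ℕ→ℚ (suc d) * ((1ℚ - two * ε) * h)   ≡⟨ sym (*-assoc (ℕ→ℚ (suc d)) (1ℚ - two * ε) h) ⟩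
    ℕ→ℚ (suc d) * (1ℚ - two * ε) * h     ≤⟨ *-monoʳ-≤-0≤ 0≤h (kernel-coefficient d 0≤ε 1≤dε) ⟩
    ℕ→ℚ d * (1ℚ - ε) * h                 ≤⟨ degrees ⟩
    ℕ→ℚ (suc d) * m                      ∎)
    where open ≤-Reasoning

  -- 1 - 2ε = 1/2 + 2(1/4 - ε) ≥ 1/2, so h ≤ 2 (1 - 2ε) h ≤ 2 m₀ ≤ 4 μ.
  ≤four* : ∀ {ε h m₀ μ} → ε < + 1 / 4 → 0ℚ ≤ h → (1ℚ - two * ε) * h ≤ m₀ → m₀ ≤ μ + μ →
    h ≤ four * μ
  ≤four* {ε} {h} {m₀} {μ} ε<¼ 0≤h covered m₀≤2μ = begin
    h                            ≡⟨ solve 1 (λ x → x := con two :* (con half :* x)) refl h ⟩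
    two * (half * h)             ≤⟨ *-monoˡ-≤-0≤ (ℕ→ℚ-nonNeg 2) (*-monoʳ-≤-0≤ 0≤h half≤) ⟩
    two * ((1ℚ - two * ε) * h)   ≤⟨ *-monoˡ-≤-0≤ (ℕ→ℚ-nonNeg 2) (≤-trans covered m₀≤2μ) ⟩
    two * (μ + μ)                ≡⟨ solve 1 (λ x → con two :* (x :+ x) := con four :* x) refl μ ⟩
    four * μ                     ∎
    where
    open ≤-Reasoning
    half = + 1 / 2
    half≤ : half ≤ 1ℚ - two * ε
    half≤ = subst (half ≤_) (solve 1 (λ e → con half :+ con two :* (con (+ 1 / 4) :- e) := con 1ℚ :- con two :* e) refl ε)
              (x≤x+y (0≤* (ℕ→ℚ-nonNeg 2) (0≤y-x (<⇒≤ ε<¼))))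

  unmatched≤ : ∀ {a u h m} → u + m ≡ h → (1ℚ - a) * h ≤ m → u ≤ a * h
  unmatched≤ {a} {u} {h} {m} u+m≡h covered = begin
    u                   ≡⟨ solve 2 (λ x y → x := (x :+ y) :- y) refl u m ⟩
    (u + m) - m         ≡⟨ cong (_- m) u+m≡h ⟩
    h - m               ≤⟨ +-monoʳ-≤ h (neg-antimono-≤ covered) ⟩
    h - (1ℚ - a) * h    ≡⟨ solve 2 (λ x y → y :- (con 1ℚ :- x) :* y := x :* y) refl a h ⟩
    a * h               ∎
    where open ≤-Reasoning

module Kernels where

  open import Data.Nat as ℕ using (ℕ; suc)
  import Data.Nat.Properties as ℕ
  open import Data.Bool using (Bool; true; false; T; not; _∧_; if_then_else_)
  open import Data.Bool.Properties using (T-∧)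
  open import Data.Fin using (Fin)
  open import Data.Product using (∃; _×_; _,_; proj₁; proj₂)
  open import Data.Sum using (_⊎_; inj₁; inj₂)
  open import Data.Integer using (+_)
  open import Data.Rational using (ℚ; _/_; 0ℚ; 1ℚ; _+_; _-_; _*_; _≤_; _<_)
  open import Data.Rational.Properties using (≤-trans; <⇒≤; ≤ᵇ⇒≤; ≤⇒≤ᵇ; module ≤-Reasoning)
  open import Data.Rational.Solver using (module +-*-Solver)
  open +-*-Solver
  open import Function using (_∘_)
  open import Function.Bundles using (module Equivalence)
  open import Relation.Binary.PropositionalEquality using (_≡_; refl; sym; trans; cong; subst)
  open import Defs hiding (sym)
  open NatEmbedding
  open KernelArithmetic
  open Counting using (sum-syntax; count-split)
  open Graphs
  open MaximalMatchings using (extend-to-maximal)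

  unmatchedH : ∀ {n} → ℚ → ℕ → Graph n → Graph n → Fin n → Bool
  unmatchedH ε d K M v = inH ε d K v ∧ not (matchedᵇ M v)

  high-degree-coverable : ∀ {n ε d} (K : Graph n) → 0ℚ ≤ ε → 1ℚ ≤ ℕ→ℚ d * ε → (∀ v → deg K v ℕ.≤ d) →
    ∃ λ M → IsMatching K M × (1ℚ - two * ε) * ℕ→ℚ (sizeH ε d K) ≤ ℕ→ℚ (matchedH ε d K M)
  high-degree-coverable {n} {ε} {d} K 0≤ε 1≤dε deg≤d = covering (EdgeColouring.matching-covering K d deg≤d (inH ε d K))
    where
    ∑H = ∑[ v < n ] (if inH ε d K v then deg K v else 0)
    covering : (∃ λ M → IsMatching K M × ∑H ℕ.≤ suc d ℕ.* matchedH ε d K M) →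
      ∃ λ M → IsMatching K M × (1ℚ - two * ε) * ℕ→ℚ (sizeH ε d K) ≤ ℕ→ℚ (matchedH ε d K M)
    covering (M , matching , ∑deg≤) = M , matching ,
      covered-fraction d 0≤ε 1≤dε (ℕ→ℚ-nonNeg (sizeH ε d K)) (begin
        ℕ→ℚ d * (1ℚ - ε) * ℕ→ℚ (sizeH ε d K)
          ≤⟨ *count≤∑ (inH ε d K) (deg K) {ℕ→ℚ d * (1ℚ - ε)} (λ v → ≤ᵇ⇒≤) ⟩
        ℕ→ℚ ∑H                                  ≤⟨ ℕ→ℚ-mono-≤ {∑H} {suc d ℕ.* matchedH ε d K M} ∑deg≤ ⟩
        ℕ→ℚ (suc d ℕ.* matchedH ε d K M)       ≡⟨ ℕ→ℚ-* (suc d) (matchedH ε d K M) ⟩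
        ℕ→ℚ (suc d) * ℕ→ℚ (matchedH ε d K M)   ∎)
      where open ≤-Reasoning

  module Kernel {n} (ε : ℚ) (d : ℕ) (G K : Graph n) (kernel : IsKernel ε d G K) where

    maximal-after-deleting-unmatchedH : ∀ {M} → IsMaximalMatching K M →
      IsMaximalMatching (deleteVertices G (unmatchedH ε d K M)) M
    maximal-after-deleting-unmatchedH {M} ((M⊆K , deg≤1) , maximal) = (M⊆G−D , deg≤1) , maximal′
      where
      K⊆G = proj₁ kernel
      D = unmatchedH ε d K M
      matched-kept : ∀ a b → T b → T (not (a ∧ not b))
      matched-kept false _    _ = _
      matched-kept true  true _ = _
      kept-high-matched : ∀ {a b} → T a → T (not (a ∧ not b)) → T b
      kept-high-matched {true} {true} _ _ = _
      kept : ∀ u v → T (adj M u v) → T (not (D u))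
      kept u v uv = matched-kept (inH ε d K u) (matchedᵇ M u) (Equivalence.to (Matched⇔matchedᵇ M u) (edge⇒Matched M uv))
      M⊆G−D : M ⊆G deleteVertices G D
      M⊆G−D u v uv = Equivalence.from T-∧ (K⊆G u v (M⊆K u v uv) ,
                       Equivalence.from T-∧ (kept u v uv , kept v u (edge-sym M uv)))
      matched-if-high : ∀ u → ℕ→ℚ d * (1ℚ - ε) ≤ ℕ→ℚ (deg K u) → T (not (D u)) → Matched M u
      matched-if-high u high ¬Du = Equivalence.from (Matched⇔matchedᵇ M u) (kept-high-matched (≤⇒≤ᵇ high) ¬Du)
      maximal′ : ∀ u v → T (adj (deleteVertices G D) u v) → Matched M u ⊎ Matched M v
      maximal′ u v uv with Equivalence.to T-∧ uv
      ... | G-uv , kept-uv with Equivalence.to T-∧ kept-uv | adj K u v in K-uv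
      ...   | ¬Du , ¬Dv | true  = maximal u v (subst T (sym K-uv) _)
      ...   | ¬Du , ¬Dv | false with proj₂ (proj₂ kernel) u v G-uv (subst (T ∘ not) (sym K-uv) _)
      ...     | inj₁ u-high = inj₁ (matched-if-high u u-high ¬Du)
      ...     | inj₂ v-high = inj₂ (matched-if-high v v-high ¬Dv)

    module _ (0<ε : 0ℚ < ε) (1≤dε : 1ℚ ≤ ℕ→ℚ d * ε) where

      Covering : (Graph n → Set) → ℚ → Set
      Covering IsGood a = ∃ λ M → IsGood M × a * ℕ→ℚ (sizeH ε d K) ≤ ℕ→ℚ (matchedH ε d K M)

      covering-matching : Covering (IsMatching K) (1ℚ - two * ε)
      covering-matching = high-degree-coverable K (<⇒≤ 0<ε) 1≤dε (proj₁ (proj₂ kernel))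

      sizeH≤4μ : ∀ {M*} → ε < + 1 / 4 → IsMaximumMatching G M* → ℕ→ℚ (sizeH ε d K) ≤ four * ℕ→ℚ (numEdges M*)
      sizeH≤4μ {M*} ε<¼ (_ , maximum) = bound covering-matching
        where
        bound : Covering (IsMatching K) (1ℚ - two * ε) → ℕ→ℚ (sizeH ε d K) ≤ four * ℕ→ℚ (numEdges M*)
        bound (M₀ , (M₀⊆K , M₀-deg≤1) , M₀-covers) =
          ≤four* {ε} {ℕ→ℚ (sizeH ε d K)} {ℕ→ℚ (matchedH ε d K M₀)} {ℕ→ℚ (numEdges M*)}
            ε<¼ (ℕ→ℚ-nonNeg (sizeH ε d K)) M₀-covers
            (subst (ℕ→ℚ (matchedH ε d K M₀) ≤_) (ℕ→ℚ-+ (numEdges M*) (numEdges M*))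
              (ℕ→ℚ-mono-≤ {matchedH ε d K M₀} {numEdges M* ℕ.+ numEdges M*}
                (ℕ.≤-trans (matchedCount≤2*numEdges (inH ε d K) M₀) (ℕ.+-mono-≤ M₀≤μ M₀≤μ))))
          where
          M₀≤μ = maximum M₀ ((λ u v uv → proj₁ kernel u v (M₀⊆K u v uv)) , M₀-deg≤1)

      few-unmatched : ∀ {c M M*} → ε < + 1 / 4 → 0ℚ < c → IsMaximumMatching G M* →
        (1ℚ - c * ε) * ℕ→ℚ (sizeH ε d K) ≤ ℕ→ℚ (matchedH ε d K M) →
        ℕ→ℚ (count (unmatchedH ε d K M)) ≤ four * c * ε * ℕ→ℚ (numEdges M*)
      few-unmatched {c} {M} {M*} ε<¼ 0<c maximum covered = begin
        u                   ≤⟨ unmatched≤ {c * ε} {u} {h} {m} split covered ⟩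
        c * ε * h           ≤⟨ *-monoˡ-≤-0≤ (0≤* (<⇒≤ 0<c) (<⇒≤ 0<ε)) (sizeH≤4μ {M*} ε<¼ maximum) ⟩
        c * ε * (four * μ)  ≡⟨ solve 3 (λ x e y → x :* e :* (con four :* y) := con four :* x :* e :* y) refl c ε μ ⟩
        four * c * ε * μ    ∎
        where
        open ≤-Reasoning
        u = ℕ→ℚ (count (unmatchedH ε d K M))
        h = ℕ→ℚ (sizeH ε d K)
        m = ℕ→ℚ (matchedH ε d K M)
        μ = ℕ→ℚ (numEdges M*)
        split : u + m ≡ h
        split = trans (sym (ℕ→ℚ-+ (count (unmatchedH ε d K M)) (matchedH ε d K M)))
                      (cong ℕ→ℚ (count-split (inH ε d K) (matchedᵇ M)))

      covering-maximal-matching : Covering (IsMaximalMatching K) (1ℚ - two * ε)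
      covering-maximal-matching = extend covering-matching
        where
        extend : Covering (IsMatching K) (1ℚ - two * ε) → Covering (IsMaximalMatching K) (1ℚ - two * ε)
        extend (M₀ , M₀-matching , M₀-covers) = grow (extend-to-maximal K {M₀} M₀-matching)
          where
          grow : (∃ λ M → IsMaximalMatching K M × M₀ ⊆G M) → Covering (IsMaximalMatching K) (1ℚ - two * ε)
          grow (M , M-maximal , M₀⊆M) = M , M-maximal , ≤-trans M₀-covers
            (ℕ→ℚ-mono-≤ {matchedH ε d K M₀} {matchedH ε d K M} (matchedCount-mono (inH ε d K) {M₀} {M} M₀⊆M))

open import Defs
open import Data.Nat using (ℕ)
open import Data.Product using (Σ; _×_; _,_)
open import Data.Integer using (+_)
open import Data.Rational using (ℚ; _/_; 0ℚ; 1ℚ; _<_; _≤_; _*_; _-_)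
open Kernels using (unmatchedH; module Kernel)

lemma5p5 : (ε c : ℚ) (d : ℕ) → 0ℚ < ε → ε < (+ 1) / 4 → 1ℚ ≤ ℕ→ℚ d * ε → 0ℚ < c →
    ∀ {n} (G K : Graph n) → IsKernel ε d G K →
    ((M : Graph n) → IsMaximalMatching K M →
      (1ℚ - c * ε) * ℕ→ℚ (sizeH ε d K) ≤ ℕ→ℚ (matchedH ε d K M) →
      IsApproxMaximalMatching (((+ 4) / 1) * c * ε) G M)
    × Σ (Graph n) (λ M → IsMaximalMatching K M
        × ((1ℚ - ((+ 2) / 1) * ε) * ℕ→ℚ (sizeH ε d K) ≤ ℕ→ℚ (matchedH ε d K M)))
lemma5p5 ε c d 0<ε ε<¼ 1≤dε 0<c G K kernel =
  (λ M maximal covered M* maximum →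
     unmatchedH ε d K M ,
     few-unmatched 0<ε 1≤dε {c} {M} {M*} ε<¼ 0<c maximum covered ,
     maximal-after-deleting-unmatchedH {M} maximal) ,
  covering-maximal-matching 0<ε 1≤dε
  where open Kernel ε d G K kernel
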